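{- Let $G=(V,E)$ be a finite connected undirected multigraph without self-loops. The following are equivalent: (i) $G$ is homogeneous; (ii) $S(G)=\theta(G)$; (iii) $D(G)=\theta(G)$; (iv) $S(G)=D(G)$.
   Context: Let $\Gamma$ be the family of spanning trees of $G$ with indicator usage vectors, $\mathrm{Adm}(\Gamma)=\{\rho\in\mathbb{R}^E_{\ge0}:\sum_{e\in\gamma}\rho(e)\ge1\ \forall\gamma\in\Gamma\}$, and $\rho^*$ the unique minimizer of $\sum_e\rho(e)^2$ over $\mathrm{Adm}(\Gamma)$. $G$ is homogeneous if $\rho^*$ is constant on $E$. A feasible partition of $V$ is a partition $P=\{V_1,\dots,V_{k_P}\}$, $k_P\ge2$, with each induced subgraph $G(V_i)$ connected; $E_P$ is the set of edges joining different parts. The strength is $S(G)=\min_P\frac{|E_P|}{k_P-1}$ over feasible partitions. The denseness of a graph $H$ is $\theta(H)=\frac{|E(H)|}{|V(H)|-1}$. The maximum denseness is $D(G)=\max_H\theta(H)$ over all vertex-induced connected subgraphs $H$ of $G$ containing at least one edge.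
   Formalization: The densities ρ in Adm(Γ), including the constant candidate for $\rho^*$ and every competitor in the energy comparison, take values in the rationals rather than the reals. -}

module Defs where

open import Data.Nat using (ℕ; zero; suc; _≤_; _∸_)
open import Data.Bool using (Bool; true; false; not)
open import Data.Fin using (Fin; zero; suc; _≟_)
open import Data.Product using (_×_; _,_; proj₁; proj₂; ∃; ∃-syntax)
open import Data.Sum using (_⊎_)
open import Data.Unit using (⊤)
open import Data.Integer using (+_)
open import Data.Rational using (ℚ; 0ℚ; 1ℚ; _+_; _*_; _/_) renaming (_≤_ to _≤ℚ_)
open import Relation.Nullary using (¬_; does)
open import Relation.Binary.PropositionalEquality using (_≡_; _≢_)
open import Function.Definitions using (Surjective)

sumℚ : (m : ℕ) → (Fin m → ℚ) → ℚ
sumℚ zero    f = 0ℚ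
sumℚ (suc m) f = f zero + sumℚ m (λ i → f (suc i))

count : (m : ℕ) → (Fin m → Bool) → ℕ
count zero    p = 0
count (suc m) p with p zero
... | true  = suc (count m (λ i → p (suc i)))
... | false = count m (λ i → p (suc i))

-- a / b as a rational; b = 0 gives the junk value 0 (never used on
-- well-formed inputs in the theorem: denominators there are ≥ 1).
frac : ℕ → ℕ → ℚ
frac a zero    = 0ℚ
frac a (suc b) = (+ a) / suc b

-- Finite undirected multigraphs without self-loops.
-- Vertices Fin n, edges Fin m; each edge has two (unordered) endpoints.

record Multigraph (n m : ℕ) : Set where
  field
    ends   : Fin m → Fin n × Fin n
    noLoop : ∀ e → proj₁ (ends e) ≢ proj₂ (ends e)

  src tgt : Fin m → Fin n
  src e = proj₁ (ends e)
  tgt e = proj₂ (ends e)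

  Joins : Fin m → Fin n → Fin n → Set
  Joins e v w = (src e ≡ v × tgt e ≡ w) ⊎ (tgt e ≡ v × src e ≡ w)

  data Reach (ok : Fin m → Set) (u : Fin n) : Fin n → Set where
    here : Reach ok u u
    step : ∀ {v w} (e : Fin m) → ok e → Reach ok u v → Joins e v w → Reach ok u w

  Connected : Set
  Connected = ∀ u v → Reach (λ _ → ⊤) u v

  InducedEdge : (Fin n → Bool) → Fin m → Set
  InducedEdge W e = (W (src e) ≡ true) × (W (tgt e) ≡ true)

  inducedEdgeᵇ : (Fin n → Bool) → Fin m → Bool
  inducedEdgeᵇ W e with W (src e) | W (tgt e)
  ... | true | true = true
  ... | _    | _    = false

  InducedConnected : (Fin n → Bool) → Set
  InducedConnected W = ∀ u v → W u ≡ true → W v ≡ true → Reach (InducedEdge W) u v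

  -- Spanning trees: edge subsets T that connect all vertices and are
  -- acyclic (every edge of T is a bridge of T, i.e. its endpoints are
  -- not connected in T minus that edge).

  InT : (Fin m → Bool) → Fin m → Set
  InT T e = T e ≡ true

  IsSpanningTree : (Fin m → Bool) → Set
  IsSpanningTree T =
    (∀ u v → Reach (InT T) u v) ×
    (∀ e → T e ≡ true → ¬ Reach (λ f → T f ≡ true × f ≢ e) (src e) (tgt e))

  treeSum : (Fin m → Bool) → (Fin m → ℚ) → ℚ
  treeSum T ρ = sumℚ m (λ e → if' (T e) (ρ e))
    where
    if' : Bool → ℚ → ℚ
    if' true  q = q
    if' false q = 0ℚ

  Admissible : (Fin m → ℚ) → Set
  Admissible ρ = (∀ e → 0ℚ ≤ℚ ρ e) × (∀ T → IsSpanningTree T → 1ℚ ≤ℚ treeSum T ρ)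

  energy : (Fin m → ℚ) → ℚ
  energy ρ = sumℚ m (λ e → ρ e * ρ e)

  -- G is homogeneous: the (unique) energy minimiser ρ* over Adm(Γ) is
  -- constant, i.e. some constant density is admissible and minimises
  -- the energy among all admissible densities.
  Homogeneous : Set
  Homogeneous = ∃[ c ] (Admissible (λ _ → c) ×
                        (∀ ρ → Admissible ρ → energy (λ _ → c) ≤ℚ energy ρ))

  θG : ℚ
  θG = frac m (n ∸ 1)

  θ : (Fin n → Bool) → ℚ
  θ W = frac (count m (inducedEdgeᵇ W)) (count n W ∸ 1)

  Candidate : (Fin n → Bool) → Set
  Candidate W = InducedConnected W × ∃[ e ] InducedEdge W e

  IsMaxDenseness : ℚ → Set
  IsMaxDenseness d = (∃[ W ] (Candidate W × θ W ≡ d)) ×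
                     (∀ W → Candidate W → θ W ≤ℚ d)

  record FeasiblePartition : Set where
    field
      k       : ℕ
      part    : Fin n → Fin k
      two≤k   : 2 ≤ k
      onto    : ∀ i → ∃[ v ] part v ≡ i
      partConn : ∀ i → InducedConnected (λ v → does (part v ≟ i))

    crossing : ℕ
    crossing = count m (λ e → not (does (part (src e) ≟ part (tgt e))))

    ratio : ℚ
    ratio = frac crossing (k ∸ 1)

  IsStrength : ℚ → Set
  IsStrength s = (∃[ P ] FeasiblePartition.ratio P ≡ s) ×
                 (∀ P → s ≤ℚ FeasiblePartition.ratio P)

{-# OPTIONS --safe #-}
-- The discrete partition and the whole vertex set give
-- S ≤ θ ≤ D, so S = θ says that θ (k - 1) ≤ |E_P| for every feasible partition P,
-- and D = θ that |E(W)| ≤ θ (|W| - 1) for every connected W. These are equivalent: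
-- collapse W into one class, or sum over the classes of P.
-- An admissible constant is at least 1 / (n - 1), as spanning trees have n - 1
-- edges. If ρ* is a constant c then, since every spanning tree meets E_P at least
-- k - 1 times, 1_{E_P} / (k - 1) is admissible, and the first-order condition
-- Σ ρ* (ρ - ρ*) ≥ 0 gives |E_P| / (k - 1) ≥ |E| c ≥ θ. Conversely, if S = θ, a
-- spanning tree T built by Kruskal's algorithm gives Σ ρ ≥ S ρ(T) ≥ θ for every
-- admissible ρ, hence Σ ρ² ≥ |E| (θ / |E|)², the energy of the constant 1 / (n - 1).
module Submission where

open import Data.Nat as ℕ using (ℕ; zero; suc; _≤_; _<_; z≤n; s≤s; _∸_)
import Data.Nat.Properties as ℕₚ
open import Data.Bool using (Bool; true; false; not; _∧_; _∨_; if_then_else_)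
import Data.Bool.Properties as Boolₚ
open import Data.Fin as Fin using (Fin; zero; suc; _≟_; punchIn; punchOut)
import Data.Fin.Properties as Finₚ
open import Data.Product using (_×_; _,_; proj₁; proj₂; ∃-syntax; ∃₂; Σ-syntax; map₂)
open import Data.Sum using (_⊎_; inj₁; inj₂)
open import Data.Empty using (⊥; ⊥-elim)
open import Function using (_∘_)
open import Function.Bundles using (_⇔_; mk⇔; Equivalence)
open import Function.Construct.Composition using (_⇔-∘_)
open import Function.Construct.Symmetry using (⇔-sym)
open import Relation.Nullary using (¬_; yes; no; does; Dec)
open import Relation.Nullary.Decidable using (dec-true; dec-false)
open import Relation.Binary.PropositionalEquality
open import Data.Integer as ℤ using (+_)
import Data.Integer.Properties as ℤₚ
open import Data.Rational as ℚ using (ℚ; 0ℚ; 1ℚ; _+_; _*_; _-_; -_; _/_; toℚᵘ)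
  renaming (_≤_ to _≤ℚ_; _<_ to _<ℚ_)
import Data.Rational.Properties as ℚₚ
import Data.Rational.Unnormalised as ℚᵘ
import Data.Rational.Unnormalised.Properties as ℚᵘₚ
open import Data.Rational.Solver using (module +-*-Solver)
open +-*-Solver using (solve; _:+_; _:*_; _:-_; :-_; _:=_; con)
open import Defs
open import Algebra.Properties.CommutativeMonoid.Sum ℕₚ.+-0-commutativeMonoid
  using (sum; sum-cong-≗; ∑-distrib-+; sum-replicate-zero)

boolToℕ : Bool → ℕ
boolToℕ true  = 1
boolToℕ false = 0

∧-true : ∀ {a b} → a ≡ true → b ≡ true → a ∧ b ≡ true
∧-true refl refl = refl

≟⇒≡ : ∀ {k} {i j : Fin k} → does (i ≟ j) ≡ true → i ≡ j
≟⇒≡ {i = i} {j} h with i ≟ j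
... | yes i≡j = i≡j

does-suc : ∀ {k} (i j : Fin k) → does (Fin.suc i ≟ suc j) ≡ does (i ≟ j)
does-suc i j with i ≟ j
... | yes refl = refl
... | no  _    = refl

insert : ∀ {k} → Fin k → (Fin k → Bool) → Fin k → Bool
insert x D v = D v ∨ does (v ≟ x)

insert-self : ∀ {k} x (D : Fin k → Bool) → insert x D x ≡ true
insert-self x D rewrite dec-true (x ≟ x) refl = Boolₚ.∨-zeroʳ (D x)

insert-⊇ : ∀ {k} x (D : Fin k → Bool) v → D v ≡ true → insert x D v ≡ true
insert-⊇ x D v Dv rewrite Dv = refl

insert-other : ∀ {k} x (D : Fin k → Bool) v → v ≢ x → insert x D v ≡ D v
insert-other x D v v≢x rewrite dec-false (v ≟ x) v≢x = Boolₚ.∨-identityʳ (D v)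

insert-cases : ∀ {k} x (D : Fin k → Bool) v → insert x D v ≡ true → D v ≡ true ⊎ v ≡ x
insert-cases x D v h with v ≟ x
... | yes v≡x = inj₂ v≡x
... | no  _   = inj₁ (trans (sym (Boolₚ.∨-identityʳ (D v))) h)

count-suc : ∀ m (p : Fin (suc m) → Bool) → count (suc m) p ≡ boolToℕ (p zero) ℕ.+ count m (p ∘ suc)
count-suc m p with p zero
... | true  = refl
... | false = refl

count-cong : ∀ m {p q : Fin m → Bool} → (∀ i → p i ≡ q i) → count m p ≡ count m q
count-cong zero    p≗q = refl
count-cong (suc m) {p} {q} p≗q rewrite count-suc m p | count-suc m q | p≗q zero =
  cong (boolToℕ (q zero) ℕ.+_) (count-cong m (p≗q ∘ suc))

count-mono : ∀ m {p q : Fin m → Bool} → (∀ i → p i ≡ true → q i ≡ true) → count m p ≤ count m q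
count-mono zero    p⊆q = z≤n
count-mono (suc m) {p} {q} p⊆q rewrite count-suc m p | count-suc m q =
  ℕₚ.+-mono-≤ (head-mono (p zero) (q zero) (p⊆q zero)) (count-mono m (p⊆q ∘ suc))
  where
  head-mono : ∀ a b → (a ≡ true → b ≡ true) → boolToℕ a ≤ boolToℕ b
  head-mono false b    _   = z≤n
  head-mono true  true _   = ℕₚ.≤-refl
  head-mono true  false a⇒b with a⇒b refl
  ... | ()

count-all-true : ∀ m {p : Fin m → Bool} → (∀ i → p i ≡ true) → count m p ≡ m
count-all-true zero    all = refl
count-all-true (suc m) {p} all rewrite count-suc m p | all zero = cong suc (count-all-true m (all ∘ suc))

count-all-false : ∀ m {p : Fin m → Bool} → (∀ i → p i ≡ false) → count m p ≡ 0
count-all-false zero    none = refl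
count-all-false (suc m) {p} none rewrite count-suc m p | none zero = count-all-false m (none ∘ suc)

count≡0⇒false : ∀ m (p : Fin m → Bool) → count m p ≡ 0 → ∀ i → p i ≡ false
count≡0⇒false (suc m) p c≡0 i with p zero in p₀
count≡0⇒false (suc m) p c≡0 zero    | false = p₀
count≡0⇒false (suc m) p c≡0 (suc i) | false = count≡0⇒false m (p ∘ suc) c≡0 i

count≡suc⇒true : ∀ m (p : Fin m → Bool) {c} → count m p ≡ suc c → ∃[ i ] p i ≡ true
count≡suc⇒true (suc m) p c≡1+ with p zero in p₀
... | true  = zero , p₀
... | false with count≡suc⇒true m (p ∘ suc) c≡1+
...   | i , pi = suc i , pi

none-or-some : ∀ m (p : Fin m → Bool) → (∀ i → p i ≡ false) ⊎ ∃[ i ] p i ≡ true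
none-or-some zero    p = inj₁ λ ()
none-or-some (suc m) p with p zero in p₀ | none-or-some m (p ∘ suc)
... | true  | _                = inj₂ (zero , p₀)
... | false | inj₁ none        = inj₁ λ { zero → p₀ ; (suc i) → none i }
... | false | inj₂ (i , pi)    = inj₂ (suc i , pi)

count-+-not : ∀ m (p : Fin m → Bool) → count m p ℕ.+ count m (not ∘ p) ≡ m
count-+-not zero    p = refl
count-+-not (suc m) p rewrite count-suc m p | count-suc m (not ∘ p) with p zero
... | true  = cong suc (count-+-not m (p ∘ suc))
... | false = trans (ℕₚ.+-suc _ _) (cong suc (count-+-not m (p ∘ suc)))

count-drop : ∀ m (p q : Fin m → Bool) (j : Fin m) → p j ≡ true → q j ≡ false →
             (∀ i → i ≢ j → p i ≡ q i) → count m p ≡ suc (count m q)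
count-drop (suc m) p q zero pj qj rest rewrite count-suc m p | count-suc m q | pj | qj =
  cong suc (count-cong m (λ i → rest (suc i) λ ()))
count-drop (suc m) p q (suc j) pj qj rest rewrite count-suc m p | count-suc m q | rest zero (λ ()) =
  trans (cong (boolToℕ (q zero) ℕ.+_) (count-drop m (p ∘ suc) (q ∘ suc) j pj qj
                                         (λ i i≢j → rest (suc i) (i≢j ∘ Finₚ.suc-injective))))
        (ℕₚ.+-suc _ _)

count-strict-mono : ∀ m {p q : Fin m → Bool} (j : Fin m) → p j ≡ false → q j ≡ true →
                    (∀ i → p i ≡ true → q i ≡ true) → count m p < count m q
count-strict-mono (suc m) {p} {q} zero pj qj p⊆q rewrite count-suc m p | count-suc m q | pj | qj =
  s≤s (count-mono m (p⊆q ∘ suc))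
count-strict-mono (suc m) {p} {q} (suc j) pj qj p⊆q rewrite count-suc m p | count-suc m q
  with p zero in p₀ | q zero in q₀
... | false | _     = ℕₚ.≤-trans (count-strict-mono m j pj qj (p⊆q ∘ suc)) (ℕₚ.m≤n+m _ (boolToℕ _))
... | true  | true  = s≤s (count-strict-mono m j pj qj (p⊆q ∘ suc))
... | true  | false with trans (sym (p⊆q zero p₀)) q₀
...   | ()

count-≥1 : ∀ m (p : Fin m → Bool) i → p i ≡ true → 1 ≤ count m p
count-≥1 m p i pi =
  subst (_< count m p) (count-all-false m (λ _ → refl)) (count-strict-mono m i refl pi (λ _ ()))

count-≥2 : ∀ m (p : Fin m → Bool) i j → i ≢ j → p i ≡ true → p j ≡ true → 2 ≤ count m p
count-≥2 m p i j i≢j pi pj = ℕₚ.≤-trans (s≤s (count-≥1 m only-i i (dec-true (i ≟ i) refl)))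
  (count-strict-mono m j (dec-false (j ≟ i) (i≢j ∘ sym)) pj
                     (λ k k≡i → subst (λ x → p x ≡ true) (sym (≟⇒≡ k≡i)) pi))
  where
  only-i : Fin m → Bool
  only-i k = does (k ≟ i)

count-insert : ∀ {k} x (D : Fin k → Bool) → D x ≡ false → count k (insert x D) ≡ suc (count k D)
count-insert {k} x D Dx≡false =
  count-drop k (insert x D) D x (insert-self x D) Dx≡false (insert-other x D)

sum-singleton : ∀ k (j : Fin k) → sum (λ i → boolToℕ (does (j ≟ i))) ≡ 1
sum-singleton (suc k) zero    = cong suc (sum-replicate-zero k)
sum-singleton (suc k) (suc j) = trans (sum-cong-≗ (λ i → cong boolToℕ (does-suc j i))) (sum-singleton k j)

count-split : ∀ m {k} (g : Fin m → Fin k) (p : Fin m → Bool) →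
              count m p ≡ sum (λ i → count m (λ e → p e ∧ does (g e ≟ i)))
count-split zero {k} g p = sym (sum-replicate-zero k)
count-split (suc m) {k} g p = sym (begin
  sum (λ i → count (suc m) (λ e → p e ∧ does (g e ≟ i)))
    ≡⟨ sum-cong-≗ (λ i → count-suc m (λ e → p e ∧ does (g e ≟ i))) ⟩
  sum (λ i → boolToℕ (p zero ∧ does (g zero ≟ i)) ℕ.+ count m (λ e → p (suc e) ∧ does (g (suc e) ≟ i)))
    ≡⟨ ∑-distrib-+ (λ i → boolToℕ (p zero ∧ does (g zero ≟ i)))
                   (λ i → count m (λ e → p (suc e) ∧ does (g (suc e) ≟ i))) ⟩
  sum (λ i → boolToℕ (p zero ∧ does (g zero ≟ i))) ℕ.+ sum (λ i → count m (λ e → p (suc e) ∧ does (g (suc e) ≟ i)))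
    ≡⟨ cong₂ ℕ._+_ (head (p zero)) (count-split m (g ∘ suc) (p ∘ suc)) ⟨
  boolToℕ (p zero) ℕ.+ count m (p ∘ suc)
    ≡⟨ count-suc m p ⟨
  count (suc m) p ∎)
  where
  open ≡-Reasoning
  head : ∀ b → boolToℕ b ≡ sum (λ i → boolToℕ (b ∧ does (g zero ≟ i)))
  head true  = sym (sum-singleton k (g zero))
  head false = sym (sum-replicate-zero k)

pred-+ : ∀ {a b c} → 1 ≤ a → 1 ≤ b → a ℕ.+ b ≡ suc c → (a ∸ 1) ℕ.+ (b ∸ 1) ≡ c ∸ 1
pred-+ {suc a} {suc b} {c} _ _ a+b≡1+c = sym (trans (cong (_∸ 1) (ℕₚ.suc-injective (sym a+b≡1+c)))
                                                   (cong (_∸ 1) (ℕₚ.+-suc a b)))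

sum-pred : ∀ k (f : Fin k → ℕ) → (∀ i → 1 ≤ f i) → sum (λ i → f i ∸ 1) ℕ.+ k ≡ sum f
sum-pred zero    f _   = refl
sum-pred (suc k) f 1≤f = begin
  (f zero ∸ 1 ℕ.+ sum (λ i → f (suc i) ∸ 1)) ℕ.+ suc k  ≡⟨ ℕₚ.+-suc _ k ⟩
  suc ((f zero ∸ 1 ℕ.+ sum (λ i → f (suc i) ∸ 1)) ℕ.+ k) ≡⟨ cong suc (ℕₚ.+-assoc (f zero ∸ 1) _ k) ⟩
  suc (f zero ∸ 1) ℕ.+ (sum (λ i → f (suc i) ∸ 1) ℕ.+ k) ≡⟨ cong₂ ℕ._+_ (ℕₚ.m+[n∸m]≡n (1≤f zero))
                                                                        (sum-pred k (f ∘ suc) (1≤f ∘ suc)) ⟩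
  f zero ℕ.+ sum (f ∘ suc)                                ∎
  where open ≡-Reasoning

ℕq : ℕ → ℚ
ℕq n = + n / 1

toℚᵘ-ℕq : ∀ n → toℚᵘ (ℕq n) ℚᵘ.≃ ℚᵘ.mkℚᵘ (+ n) 0
toℚᵘ-ℕq n = ℚₚ.toℚᵘ-fromℚᵘ (ℚᵘ.mkℚᵘ (+ n) 0)

ℕq-+ : ∀ a b → ℕq (a ℕ.+ b) ≡ ℕq a + ℕq b
ℕq-+ a b = ℚₚ.toℚᵘ-injective (begin
  toℚᵘ (ℕq (a ℕ.+ b))                  ≈⟨ toℚᵘ-ℕq (a ℕ.+ b) ⟩
  ℚᵘ.mkℚᵘ (+ (a ℕ.+ b)) 0              ≈⟨ ℚᵘ.*≡* cross ⟩
  ℚᵘ.mkℚᵘ (+ a) 0 ℚᵘ.+ ℚᵘ.mkℚᵘ (+ b) 0 ≈⟨ ℚᵘₚ.+-cong (toℚᵘ-ℕq a) (toℚᵘ-ℕq b) ⟨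
  toℚᵘ (ℕq a) ℚᵘ.+ toℚᵘ (ℕq b)         ≈⟨ ℚₚ.toℚᵘ-homo-+ (ℕq a) (ℕq b) ⟨
  toℚᵘ (ℕq a + ℕq b)                   ∎)
  where
  open ℚᵘₚ.≃-Reasoning
  cross : + (a ℕ.+ b) ℤ.* + 1 ≡ (+ a ℤ.* + 1 ℤ.+ + b ℤ.* + 1) ℤ.* + (1 ℕ.* 1)
  cross rewrite ℤₚ.*-identityʳ (+ a) | ℤₚ.*-identityʳ (+ b) | ℤₚ.*-identityʳ (+ a ℤ.+ + b) = refl

ℕq-suc : ∀ n → ℕq (suc n) ≡ 1ℚ + ℕq n
ℕq-suc n = ℕq-+ 1 n

ℕq-nonneg : ∀ n → 0ℚ ≤ℚ ℕq n
ℕq-nonneg n = ℚₚ.nonNegative⁻¹ (ℕq n) {{ℚₚ.normalize-nonNeg n 1}}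

ℕq-pos : ∀ {n} → 1 ≤ n → 0ℚ <ℚ ℕq n
ℕq-pos {suc n} _ = ℚₚ.positive⁻¹ (ℕq (suc n)) {{ℚₚ.normalize-pos (suc n) 1}}

≤-from-nonneg-diff : ∀ {p q} d → 0ℚ ≤ℚ d → q ≡ p + d → p ≤ℚ q
≤-from-nonneg-diff {p} {q} d 0≤d q≡p+d = begin
  p       ≡⟨ ℚₚ.+-identityʳ p ⟨
  p + 0ℚ  ≤⟨ ℚₚ.+-monoʳ-≤ p 0≤d ⟩
  p + d   ≡⟨ q≡p+d ⟨
  q       ∎
  where open ℚₚ.≤-Reasoning

≤⇒0≤- : ∀ {p q} → p ≤ℚ q → 0ℚ ≤ℚ q - p
≤⇒0≤- {p} {q} p≤q = subst (_≤ℚ q - p) (ℚₚ.+-inverseʳ p) (ℚₚ.+-monoˡ-≤ (- p) p≤q)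

≤+⇒0≤ : ∀ {p d} → p ≤ℚ p + d → 0ℚ ≤ℚ d
≤+⇒0≤ {p} {d} p≤p+d = subst (0ℚ ≤ℚ_) (solve 2 (λ p d → (p :+ d) :- p := d) refl p d) (≤⇒0≤- p≤p+d)

0≤-⇒≤ : ∀ {p q} → 0ℚ ≤ℚ q - p → p ≤ℚ q
0≤-⇒≤ {p} {q} 0≤q-p = ≤-from-nonneg-diff (q - p) 0≤q-p (solve 2 (λ p q → q := p :+ (q :- p)) refl p q)

ℕq-mono : ∀ {a b} → a ≤ b → ℕq a ≤ℚ ℕq b
ℕq-mono {a} {b} a≤b = ≤-from-nonneg-diff (ℕq (b ∸ a)) (ℕq-nonneg (b ∸ a))
  (trans (cong ℕq (sym (ℕₚ.m+[n∸m]≡n a≤b))) (ℕq-+ a (b ∸ a)))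

*-nonneg : ∀ {p q} → 0ℚ ≤ℚ p → 0ℚ ≤ℚ q → 0ℚ ≤ℚ p * q
*-nonneg {p} {q} 0≤p 0≤q = subst (_≤ℚ p * q) (ℚₚ.*-zeroʳ p) (ℚₚ.*-monoˡ-≤-nonNeg p {{ℚ.nonNegative 0≤p}} 0≤q)

*-pos : ∀ {p q} → 0ℚ <ℚ p → 0ℚ <ℚ q → 0ℚ <ℚ p * q
*-pos {p} {q} 0<p 0<q = subst (_<ℚ p * q) (ℚₚ.*-zeroʳ p) (ℚₚ.*-monoʳ-<-pos p {{ℚ.positive 0<p}} 0<q)

square-nonneg : ∀ p → 0ℚ ≤ℚ p * p
square-nonneg p with ℚₚ.≤-total 0ℚ p
... | inj₁ 0≤p = *-nonneg 0≤p 0≤p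
... | inj₂ p≤0 = subst (0ℚ ≤ℚ_) (solve 1 (λ p → (:- p) :* (:- p) := p :* p) refl p) (*-nonneg 0≤-p 0≤-p)
  where
  0≤-p : 0ℚ ≤ℚ - p
  0≤-p = ℚₚ.neg-antimono-≤ p≤0

0≤p+p⇒0≤p : ∀ {p} → 0ℚ ≤ℚ p + p → 0ℚ ≤ℚ p
0≤p+p⇒0≤p {p} 0≤p+p with 0ℚ ℚ.≤? p
... | yes 0≤p = 0≤p
... | no  0≰p = ⊥-elim (ℚₚ.<-irrefl refl (ℚₚ.≤-<-trans 0≤p+p (ℚₚ.+-mono-< (ℚₚ.≰⇒> 0≰p) (ℚₚ.≰⇒> 0≰p))))

frac-nonneg : ∀ a b → 0ℚ ≤ℚ frac a b
frac-nonneg a zero    = ℚₚ.≤-refl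
frac-nonneg a (suc b) = ℚₚ.nonNegative⁻¹ (frac a (suc b)) {{ℚₚ.normalize-nonNeg a (suc b)}}

frac-pos : ∀ {a b} → 1 ≤ a → 1 ≤ b → 0ℚ <ℚ frac a b
frac-pos {suc a} {suc b} _ _ = ℚₚ.positive⁻¹ (frac (suc a) (suc b)) {{ℚₚ.normalize-pos (suc a) (suc b)}}

frac-* : ∀ a {b} → 1 ≤ b → frac a b * ℕq b ≡ ℕq a
frac-* a {suc b} _ = ℚₚ.toℚᵘ-injective (begin
  toℚᵘ (frac a (suc b) * ℕq (suc b))               ≈⟨ ℚₚ.toℚᵘ-homo-* (frac a (suc b)) (ℕq (suc b)) ⟩
  toℚᵘ (frac a (suc b)) ℚᵘ.* toℚᵘ (ℕq (suc b))     ≈⟨ ℚᵘₚ.*-cong (ℚₚ.toℚᵘ-fromℚᵘ (ℚᵘ.mkℚᵘ (+ a) b)) (toℚᵘ-ℕq (suc b)) ⟩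
  ℚᵘ.mkℚᵘ (+ a) b ℚᵘ.* ℚᵘ.mkℚᵘ (+ suc b) 0         ≈⟨ ℚᵘ.*≡* cross ⟩
  ℚᵘ.mkℚᵘ (+ a) 0                                  ≈⟨ toℚᵘ-ℕq a ⟨
  toℚᵘ (ℕq a)                                      ∎)
  where
  open ℚᵘₚ.≃-Reasoning
  cross : (+ a ℤ.* + suc b) ℤ.* + 1 ≡ + a ℤ.* + (suc b ℕ.* 1)
  cross rewrite ℤₚ.*-identityʳ (+ a ℤ.* + suc b) | ℕₚ.*-identityʳ (suc b) = refl

≤-frac⇔ : ∀ {a b q} → 1 ≤ b → (q ≤ℚ frac a b ⇔ q * ℕq b ≤ℚ ℕq a)
≤-frac⇔ {a} {b} 1≤b = mk⇔
  (λ q≤a/b → subst (_ ≤ℚ_) (frac-* a 1≤b) (ℚₚ.*-monoʳ-≤-nonNeg (ℕq b) {{ℚ.nonNegative (ℕq-nonneg b)}} q≤a/b))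
  (λ qb≤a → ℚₚ.*-cancelʳ-≤-pos (ℕq b) {{ℚ.positive (ℕq-pos 1≤b)}} (subst (_ ≤ℚ_) (sym (frac-* a 1≤b)) qb≤a))

frac-≤⇔ : ∀ {a b q} → 1 ≤ b → (frac a b ≤ℚ q ⇔ ℕq a ≤ℚ q * ℕq b)
frac-≤⇔ {a} {b} 1≤b = mk⇔
  (λ a/b≤q → subst (_≤ℚ _) (frac-* a 1≤b) (ℚₚ.*-monoʳ-≤-nonNeg (ℕq b) {{ℚ.nonNegative (ℕq-nonneg b)}} a/b≤q))
  (λ a≤qb → ℚₚ.*-cancelʳ-≤-pos (ℕq b) {{ℚ.positive (ℕq-pos 1≤b)}} (subst (_≤ℚ _) (sym (frac-* a 1≤b)) a≤qb))

frac-scale : ∀ a {b} → 1 ≤ b → frac a b ≡ ℕq a * frac 1 b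
frac-scale a {b} 1≤b = begin
  frac a b                           ≡⟨ ℚₚ.*-identityʳ (frac a b) ⟨
  frac a b * 1ℚ                      ≡⟨ cong (frac a b *_) (trans (ℚₚ.*-comm (ℕq b) (frac 1 b)) (frac-* 1 1≤b)) ⟨
  frac a b * (ℕq b * frac 1 b)       ≡⟨ ℚₚ.*-assoc (frac a b) (ℕq b) (frac 1 b) ⟨
  frac a b * ℕq b * frac 1 b         ≡⟨ cong (_* frac 1 b) (frac-* a 1≤b) ⟩
  ℕq a * frac 1 b                    ∎
  where open ≡-Reasoning

split-≤ : ∀ {x y t a b} → x + y ≡ t * (a + b) → (t * a ≤ℚ y ⇔ x ≤ℚ t * b)
split-≤ {x} {y} {t} {a} {b} x+y≡t[a+b] = mk⇔
  (λ ta≤y → ≤-from-nonneg-diff (y - t * a) (≤⇒0≤- ta≤y) (begin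
    t * b                  ≡⟨ solve 3 (λ t a b → t :* b := t :* (a :+ b) :- t :* a) refl t a b ⟩
    t * (a + b) - t * a    ≡⟨ cong (_- t * a) x+y≡t[a+b] ⟨
    (x + y) - t * a        ≡⟨ solve 4 (λ x y t a → (x :+ y) :- t :* a := x :+ (y :- t :* a)) refl x y t a ⟩
    x + (y - t * a)        ∎))
  (λ x≤tb → ≤-from-nonneg-diff (t * b - x) (≤⇒0≤- x≤tb) (begin
    y                      ≡⟨ solve 2 (λ x y → y := (x :+ y) :- x) refl x y ⟩
    (x + y) - x            ≡⟨ cong (_- x) x+y≡t[a+b] ⟩
    t * (a + b) - x        ≡⟨ solve 4 (λ x t a b → t :* (a :+ b) :- x := t :* a :+ (t :* b :- x)) refl x t a b ⟩
    t * a + (t * b - x)    ∎))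
  where open ≡-Reasoning

descent-step : ∀ {t r x x′ δ w p p′} → t ≤ℚ r → 0ℚ ≤ℚ x → x ≡ x′ + δ → p ≡ p′ + r * δ →
               r * x′ + w ≤ℚ p′ → t * x + w ≤ℚ p
descent-step {t} {r} {x} {x′} {δ} {w} {p} {p′} t≤r 0≤x x≡ p≡ r*x′+w≤p′ = begin
  t * x + w             ≤⟨ ℚₚ.+-monoˡ-≤ w (ℚₚ.*-monoʳ-≤-nonNeg x {{ℚ.nonNegative 0≤x}} t≤r) ⟩
  r * x + w             ≡⟨ cong (λ y → r * y + w) x≡ ⟩
  r * (x′ + δ) + w      ≡⟨ solve 4 (λ r x′ δ w → r :* (x′ :+ δ) :+ w := (r :* x′ :+ w) :+ r :* δ) refl r x′ δ w ⟩
  (r * x′ + w) + r * δ  ≤⟨ ℚₚ.+-monoˡ-≤ (r * δ) r*x′+w≤p′ ⟩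
  p′ + r * δ            ≡⟨ p≡ ⟨
  p                     ∎
  where open ℚₚ.≤-Reasoning

-- Otherwise t = -a / (y - a) ∈ (0, 1] gives a + t y = -a² / (y - a) < 0.
0≤slope : ∀ a y → 0ℚ ≤ℚ y → (∀ t → 0ℚ <ℚ t → t ≤ℚ 1ℚ → 0ℚ ≤ℚ t * (a + t * y)) → 0ℚ ≤ℚ a
0≤slope a y 0≤y above with 0ℚ ℚ.≤? a
... | yes 0≤a = 0≤a
... | no  0≰a = ⊥-elim (ℚₚ.<-irrefl refl (ℚₚ.≤-<-trans (above t 0<t t≤1) t[a+ty]<0))
  where
  0<-a : 0ℚ <ℚ - a
  0<-a = ℚₚ.neg-antimono-< (ℚₚ.≰⇒> 0≰a)
  w = y - a
  0<w : 0ℚ <ℚ w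
  0<w = ℚₚ.+-mono-≤-< 0≤y 0<-a
  instance
    w≢0 : ℚ.NonZero w
    w≢0 = ℚₚ.pos⇒nonZero w {{ℚ.positive 0<w}}
  t = (- a) * ℚ.1/ w
  0<t : 0ℚ <ℚ t
  0<t = *-pos 0<-a (ℚₚ.positive⁻¹ (ℚ.1/ w) {{ℚₚ.1/pos⇒pos w {{ℚ.positive 0<w}}}})
  tw≡-a : t * w ≡ - a
  tw≡-a = trans (ℚₚ.*-assoc (- a) (ℚ.1/ w) w) (trans (cong ((- a) *_) (ℚₚ.*-inverseˡ w)) (ℚₚ.*-identityʳ (- a)))
  t≤1 : t ≤ℚ 1ℚ
  t≤1 = ℚₚ.*-cancelʳ-≤-pos w {{ℚ.positive 0<w}} (begin
    t * w   ≡⟨ tw≡-a ⟩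
    - a     ≤⟨ ≤-from-nonneg-diff y 0≤y (solve 2 (λ y a → y :- a := (:- a) :+ y) refl y a) ⟩
    w       ≡⟨ ℚₚ.*-identityˡ w ⟨
    1ℚ * w  ∎)
    where open ℚₚ.≤-Reasoning
  [a+ty]w≡-a² : (a + t * y) * w ≡ - (a * a)
  [a+ty]w≡-a² = begin
    (a + t * y) * w      ≡⟨ solve 4 (λ a t y w → (a :+ t :* y) :* w := a :* w :+ y :* (t :* w)) refl a t y w ⟩
    a * w + y * (t * w)  ≡⟨ cong (λ z → a * w + y * z) tw≡-a ⟩
    a * (y - a) + y * - a ≡⟨ solve 2 (λ a y → a :* (y :- a) :+ y :* (:- a) := :- (a :* a)) refl a y ⟩
    - (a * a)            ∎
    where open ≡-Reasoning
  0<a² : 0ℚ <ℚ a * a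
  0<a² = subst (0ℚ <ℚ_) (solve 1 (λ a → (:- a) :* (:- a) := a :* a) refl a) (*-pos 0<-a 0<-a)
  a+ty<0 : a + t * y <ℚ 0ℚ
  a+ty<0 = ℚₚ.*-cancelʳ-<-nonNeg w {{ℚ.nonNegative (ℚₚ.<⇒≤ 0<w)}}
    (subst₂ _<ℚ_ (sym [a+ty]w≡-a²) (sym (ℚₚ.*-zeroˡ w)) (ℚₚ.neg-antimono-< 0<a²))
  t[a+ty]<0 : t * (a + t * y) <ℚ 0ℚ
  t[a+ty]<0 = subst (t * (a + t * y) <ℚ_) (ℚₚ.*-zeroʳ t) (ℚₚ.*-monoʳ-<-pos t {{ℚ.positive 0<t}} a+ty<0)

sum-cong : ∀ m {f g : Fin m → ℚ} → (∀ i → f i ≡ g i) → sumℚ m f ≡ sumℚ m g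
sum-cong zero    f≗g = refl
sum-cong (suc m) f≗g = cong₂ _+_ (f≗g zero) (sum-cong m (f≗g ∘ suc))

sum-+ : ∀ m (f g : Fin m → ℚ) → sumℚ m (λ i → f i + g i) ≡ sumℚ m f + sumℚ m g
sum-+ zero    f g = sym (ℚₚ.+-identityʳ 0ℚ)
sum-+ (suc m) f g rewrite sum-+ m (f ∘ suc) (g ∘ suc) =
  solve 4 (λ a b c d → (a :+ b) :+ (c :+ d) := (a :+ c) :+ (b :+ d)) refl
    (f zero) (g zero) (sumℚ m (f ∘ suc)) (sumℚ m (g ∘ suc))

sum-*ˡ : ∀ m c (f : Fin m → ℚ) → sumℚ m (λ i → c * f i) ≡ c * sumℚ m f
sum-*ˡ zero    c f = sym (ℚₚ.*-zeroʳ c)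
sum-*ˡ (suc m) c f rewrite sum-*ˡ m c (f ∘ suc) = sym (ℚₚ.*-distribˡ-+ c (f zero) _)

sum-mono : ∀ m {f g : Fin m → ℚ} → (∀ i → f i ≤ℚ g i) → sumℚ m f ≤ℚ sumℚ m g
sum-mono zero    f≤g = ℚₚ.≤-refl
sum-mono (suc m) f≤g = ℚₚ.+-mono-≤ (f≤g zero) (sum-mono m (f≤g ∘ suc))

sum-nonneg : ∀ m {f : Fin m → ℚ} → (∀ i → 0ℚ ≤ℚ f i) → 0ℚ ≤ℚ sumℚ m f
sum-nonneg zero    0≤f = ℚₚ.≤-refl
sum-nonneg (suc m) 0≤f = ℚₚ.+-mono-≤ (0≤f zero) (sum-nonneg m (0≤f ∘ suc))

sum-differ-at : ∀ m (f g : Fin m → ℚ) (j : Fin m) x → f j ≡ g j + x →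
                (∀ i → i ≢ j → f i ≡ g i) → sumℚ m f ≡ sumℚ m g + x
sum-differ-at (suc m) f g zero x fj rest rewrite fj | sum-cong m {f ∘ suc} {g ∘ suc} (λ i → rest (suc i) λ ()) =
  solve 3 (λ a b c → (a :+ c) :+ b := (a :+ b) :+ c) refl (g zero) (sumℚ m (g ∘ suc)) x
sum-differ-at (suc m) f g (suc j) x fj rest
  rewrite rest zero (λ ())
        | sum-differ-at m (f ∘ suc) (g ∘ suc) j x fj (λ i i≢j → rest (suc i) (i≢j ∘ Finₚ.suc-injective)) =
  sym (ℚₚ.+-assoc (g zero) _ x)

sum-indicator : ∀ m (p : Fin m → Bool) c → sumℚ m (λ i → if p i then c else 0ℚ) ≡ ℕq (count m p) * c
sum-indicator zero    p c = sym (ℚₚ.*-zeroˡ c)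
sum-indicator (suc m) p c = begin
  (if p zero then c else 0ℚ) + sumℚ m (λ i → if p (suc i) then c else 0ℚ)
    ≡⟨ cong₂ _+_ (head (p zero)) (sum-indicator m (p ∘ suc) c) ⟩
  ℕq (boolToℕ (p zero)) * c + ℕq (count m (p ∘ suc)) * c
    ≡⟨ ℚₚ.*-distribʳ-+ c (ℕq (boolToℕ (p zero))) (ℕq (count m (p ∘ suc))) ⟨
  (ℕq (boolToℕ (p zero)) + ℕq (count m (p ∘ suc))) * c
    ≡⟨ cong (_* c) (trans (cong ℕq (count-suc m p)) (ℕq-+ (boolToℕ (p zero)) (count m (p ∘ suc)))) ⟨
  ℕq (count (suc m) p) * c ∎
  where
  open ≡-Reasoning
  head : ∀ b → (if b then c else 0ℚ) ≡ ℕq (boolToℕ b) * c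
  head true  = sym (ℚₚ.*-identityˡ c)
  head false = sym (ℚₚ.*-zeroˡ c)

sum-const : ∀ m c → sumℚ m (λ _ → c) ≡ ℕq m * c
sum-const m c = trans (sum-indicator m (λ _ → true) c) (cong (λ k → ℕq k * c) (count-all-true m (λ _ → refl)))

ℕq-sum : ∀ k (f : Fin k → ℕ) → ℕq (sum f) ≡ sumℚ k (ℕq ∘ f)
ℕq-sum zero    f = refl
ℕq-sum (suc k) f = trans (ℕq-+ (f zero) (sum (f ∘ suc))) (cong (λ z → ℕq (f zero) + z) (ℕq-sum k (f ∘ suc)))

none-or-minimum : ∀ m (p : Fin m → Bool) (f : Fin m → ℚ) →
                  (∀ i → p i ≡ false) ⊎ ∃[ j ] p j ≡ true × (∀ i → p i ≡ true → f j ≤ℚ f i)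
none-or-minimum zero    p f = inj₁ λ ()
none-or-minimum (suc m) p f with none-or-minimum m (p ∘ suc) (f ∘ suc) | p zero in p₀
... | inj₁ none            | false = inj₁ λ { zero → p₀ ; (suc i) → none i }
... | inj₁ none            | true  = inj₂ (zero , p₀ , λ { zero _ → ℚₚ.≤-refl ; (suc i) pi → ⊥-elim (Boolₚ.not-¬ (none i) pi) })
... | inj₂ (j , pj , min) | false = inj₂ (suc j , pj , λ { zero pi → ⊥-elim (Boolₚ.not-¬ p₀ pi) ; (suc i) pi → min i pi })
... | inj₂ (j , pj , min) | true with f zero ℚ.≤? f (suc j)
...   | yes f₀≤ = inj₂ (zero , p₀ , λ { zero _ → ℚₚ.≤-refl ; (suc i) pi → ℚₚ.≤-trans f₀≤ (min i pi) })
...   | no  f₀≰ = inj₂ (suc j , pj , λ { zero _ → ℚₚ.<⇒≤ (ℚₚ.≰⇒> f₀≰) ; (suc i) pi → min i pi })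

const-minimises-squares : ∀ m c (ρ : Fin m → ℚ) → 0ℚ ≤ℚ c → ℕq m * c ≤ℚ sumℚ m ρ →
                          sumℚ m (λ _ → c * c) ≤ℚ sumℚ m (λ i → ρ i * ρ i)
const-minimises-squares m c ρ 0≤c mc≤Σρ =
  ≤-from-nonneg-diff (Σ[ρ-c]² + (c + c) * (Σρ - M * c))
    (ℚₚ.+-mono-≤ (sum-nonneg m (λ i → square-nonneg (ρ i - c)))
                 (*-nonneg (ℚₚ.+-mono-≤ 0≤c 0≤c) (≤⇒0≤- mc≤Σρ)))
    (begin
      Σρ²
        ≡⟨ solve 4 (λ e s m c → e := m :* (c :* c) :+ ((e :+ ((:- (c :+ c)) :* s :+ m :* (c :* c))) :+ (c :+ c) :* (s :- m :* c)))
                   refl Σρ² Σρ M c ⟩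
      M * (c * c) + ((Σρ² + ((- (c + c)) * Σρ + M * (c * c))) + (c + c) * (Σρ - M * c))
        ≡⟨ cong₂ (λ x y → x + (y + (c + c) * (Σρ - M * c))) (sym (sum-const m (c * c))) (sym squares≡) ⟩
      sumℚ m (λ _ → c * c) + (Σ[ρ-c]² + (c + c) * (Σρ - M * c)) ∎)
  where
  open ≡-Reasoning
  M = ℕq m
  Σρ = sumℚ m ρ
  Σρ² = sumℚ m (λ i → ρ i * ρ i)
  Σ[ρ-c]² = sumℚ m (λ i → (ρ i - c) * (ρ i - c))
  squares≡ : Σ[ρ-c]² ≡ Σρ² + ((- (c + c)) * Σρ + M * (c * c))
  squares≡ = begin
    Σ[ρ-c]²
      ≡⟨ sum-cong m (λ i → solve 2 (λ r c → (r :- c) :* (r :- c) := r :* r :+ ((:- (c :+ c)) :* r :+ c :* c)) refl (ρ i) c) ⟩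
    sumℚ m (λ i → ρ i * ρ i + ((- (c + c)) * ρ i + c * c))
      ≡⟨ trans (sum-+ m _ _) (cong (λ z → Σρ² + z) (sum-+ m _ _)) ⟩
    Σρ² + (sumℚ m (λ i → (- (c + c)) * ρ i) + sumℚ m (λ _ → c * c))
      ≡⟨ cong₂ (λ x y → Σρ² + (x + y)) (sum-*ˡ m (- (c + c)) ρ) (sum-const m (c * c)) ⟩
    Σρ² + ((- (c + c)) * Σρ + M * (c * c)) ∎

fuse : ∀ {k} (i j : Fin (suc k)) → i ≢ j → Fin (suc k) → Fin k
fuse i j i≢j x with x ≟ i
... | yes _   = punchOut i≢j
... | no  x≢i = punchOut (x≢i ∘ sym)

fuse-identifies : ∀ {k} (i j : Fin (suc k)) (i≢j : i ≢ j) → fuse i j i≢j i ≡ fuse i j i≢j j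
fuse-identifies i j i≢j with i ≟ i | j ≟ i
... | no i≢i  | _       = ⊥-elim (i≢i refl)
... | yes _   | yes j≡i = ⊥-elim (i≢j (sym j≡i))
... | yes _   | no  _   = Finₚ.punchOut-cong i refl

fuse-apart : ∀ {k} (i j : Fin (suc k)) (i≢j : i ≢ j) x (x≢i : x ≢ i) → fuse i j i≢j x ≡ punchOut (x≢i ∘ sym)
fuse-apart i j i≢j x x≢i with x ≟ i
... | yes x≡i = ⊥-elim (x≢i x≡i)
... | no  _   = Finₚ.punchOut-cong i refl

fuse-onto : ∀ {k} (i j : Fin (suc k)) (i≢j : i ≢ j) z → ∃[ x ] fuse i j i≢j x ≡ z
fuse-onto i j i≢j z = punchIn i z ,
  trans (fuse-apart i j i≢j (punchIn i z) (Finₚ.punchInᵢ≢i i z)) (Finₚ.punchOut-punchIn i)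

fuse-inv : ∀ {k} (i j : Fin (suc k)) (i≢j : i ≢ j) x y → fuse i j i≢j x ≡ fuse i j i≢j y →
           x ≡ y ⊎ ((x ≡ i ⊎ x ≡ j) × (y ≡ i ⊎ y ≡ j))
fuse-inv i j i≢j x y eq with x ≟ i | y ≟ i
... | yes x≡i | yes y≡i = inj₁ (trans x≡i (sym y≡i))
... | yes x≡i | no  _   = inj₂ (inj₁ x≡i , inj₂ (sym (Finₚ.punchOut-injective i≢j _ eq)))
... | no  _   | yes y≡i = inj₂ (inj₂ (Finₚ.punchOut-injective _ i≢j eq) , inj₁ y≡i)
... | no  x≢i | no  y≢i = inj₁ (Finₚ.punchOut-injective (x≢i ∘ sym) (y≢i ∘ sym) eq)

Fin1-≡ : (i j : Fin 1) → i ≡ j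
Fin1-≡ zero zero = refl

two-vertices : ∀ {n} → 2 ≤ n → ∃₂ λ (v w : Fin n) → v ≢ w
two-vertices {suc zero}    (s≤s ())
two-vertices {suc (suc n)} _ = zero , suc zero , λ ()

Onto : ∀ {n k} → (Fin n → Fin k) → Set
Onto f = ∀ i → ∃[ v ] f v ≡ i

record Labelling (n k : ℕ) : Set where
  field
    label : Fin n → Fin k
    onto  : Onto label

open Labelling public

identityLabelling : ∀ {n} → Labelling n n
identityLabelling = record { label = λ v → v ; onto = λ i → i , refl }

constant⇒≤1 : ∀ {n k} (L : Labelling n k) → (∀ v w → label L v ≡ label L w) → k ≤ 1
constant⇒≤1 {k = zero}          L const = z≤n
constant⇒≤1 {k = suc zero}      L const = s≤s z≤n
constant⇒≤1 {k = suc (suc k)}   L const with onto L zero | onto L (suc zero)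
... | v , v↦0 | w , w↦1 with trans (sym v↦0) (trans (const v w) w↦1)
...   | ()

two-labels⇒2≤n : ∀ {n k} (L : Labelling n k) → 2 ≤ k → 2 ≤ n
two-labels⇒2≤n {k = suc zero} L (s≤s ())
two-labels⇒2≤n {n} {suc (suc k)} L _ with onto L zero | onto L (suc zero)
... | v , v↦0 | w , w↦1 = subst (2 ≤_) (count-all-true n (λ _ → refl)) (count-≥2 n (λ _ → true) v w v≢w refl refl)
  where
  v≢w : v ≢ w
  v≢w refl = Finₚ.0≢1+n (trans (sym v↦0) w↦1)

module _ {n k} (L : Labelling n (suc k)) (a b : Fin n) (a≁b : label L a ≢ label L b) where

  glue : Labelling n k
  glue = record { label = fuse′ ∘ label L ; onto = onto′ }
    where
    fuse′ = fuse (label L a) (label L b) a≁b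
    onto′ : Onto (fuse′ ∘ label L)
    onto′ z with fuse-onto (label L a) (label L b) a≁b z
    ... | x , x↦z with onto L x
    ...   | v , v↦x = v , trans (cong fuse′ v↦x) x↦z

  glue-≡ : ∀ {v w} → label L v ≡ label L w → label glue v ≡ label glue w
  glue-≡ = cong (fuse (label L a) (label L b) a≁b)

  glue-joins : label glue a ≡ label glue b
  glue-joins = fuse-identifies (label L a) (label L b) a≁b

  glue-inv : ∀ v w → label glue v ≡ label glue w →
             label L v ≡ label L w ⊎ ((label L v ≡ label L a ⊎ label L v ≡ label L b) ×
                                     (label L w ≡ label L a ⊎ label L w ≡ label L b))
  glue-inv v w = fuse-inv (label L a) (label L b) a≁b (label L v) (label L w)

Collapses : ∀ {n k} → (Fin n → Bool) → Labelling n k → Set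
Collapses W L = ∀ v w → label L v ≡ label L w ⇔ (v ≡ w ⊎ (W v ≡ true × W w ≡ true))

collapse-insert : ∀ {n k} {D : Fin n → Bool} {w₀ v₁} (L : Labelling n (suc k)) → Collapses D L →
                  D w₀ ≡ true → D v₁ ≡ false → Σ[ L′ ∈ Labelling n k ] Collapses (insert v₁ D) L′
collapse-insert {D = D} {w₀} {v₁} L L↠D Dw₀ Dv₁ = L′ , L′↠D′
  where
  v₁≁w₀ : label L v₁ ≢ label L w₀
  v₁≁w₀ v₁~w₀ with Equivalence.to (L↠D v₁ w₀) v₁~w₀
  ... | inj₁ refl            = Boolₚ.not-¬ Dv₁ Dw₀
  ... | inj₂ (Dv₁≡true , _) = Boolₚ.not-¬ Dv₁ Dv₁≡true
  L′ = glue L v₁ w₀ v₁≁w₀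
  D′ = insert v₁ D
  into-D′ : ∀ {x y} → D y ≡ true ⊎ y ≡ v₁ → label L x ≡ label L y → D′ x ≡ true
  into-D′ {x} {y} y∈D′ x~y with Equivalence.to (L↠D x y) x~y | y∈D′
  ... | inj₂ (Dx , _) | _          = insert-⊇ v₁ D x Dx
  ... | inj₁ refl     | inj₁ Dy   = insert-⊇ v₁ D x Dy
  ... | inj₁ refl     | inj₂ refl = insert-self v₁ D
  joins-w₀ : ∀ x → D′ x ≡ true → label L′ x ≡ label L′ w₀
  joins-w₀ x D′x with insert-cases v₁ D x D′x
  ... | inj₁ Dx   = glue-≡ L v₁ w₀ v₁≁w₀ (Equivalence.from (L↠D x w₀) (inj₂ (Dx , Dw₀)))
  ... | inj₂ refl = glue-joins L v₁ w₀ v₁≁w₀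
  in-glued-class : ∀ x → label L x ≡ label L v₁ ⊎ label L x ≡ label L w₀ → D′ x ≡ true
  in-glued-class x (inj₁ x~v₁) = into-D′ (inj₂ refl) x~v₁
  in-glued-class x (inj₂ x~w₀) = into-D′ (inj₁ Dw₀) x~w₀
  L′↠D′ : Collapses D′ L′
  L′↠D′ v w = mk⇔ to from
    where
    to : label L′ v ≡ label L′ w → v ≡ w ⊎ (D′ v ≡ true × D′ w ≡ true)
    to v~w with glue-inv L v₁ w₀ v₁≁w₀ v w v~w
    ... | inj₂ (v~ , w~) = inj₂ (in-glued-class v v~ , in-glued-class w w~)
    ... | inj₁ v~w₀ with Equivalence.to (L↠D v w) v~w₀
    ...   | inj₁ v≡w       = inj₁ v≡w
    ...   | inj₂ (Dv , Dw) = inj₂ (insert-⊇ v₁ D v Dv , insert-⊇ v₁ D w Dw)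
    from : v ≡ w ⊎ (D′ v ≡ true × D′ w ≡ true) → label L′ v ≡ label L′ w
    from (inj₁ refl)         = refl
    from (inj₂ (D′v , D′w)) = trans (joins-w₀ v D′v) (sym (joins-w₀ w D′w))

-- W is collapsed one vertex at a time, starting from the identity labelling,
-- which collapses {w₀}.
collapse : ∀ {n} (W : Fin n → Bool) {w₀} → W w₀ ≡ true →
           ∃[ k ] Σ[ L ∈ Labelling n k ] Collapses W L × k ℕ.+ count n W ≡ suc n
collapse {n} W {w₀} Ww₀ = grow _ only-w₀ (dec-true (w₀ ≟ w₀) refl) only⊆W refl identityLabelling collapses-only size
  where
  only-w₀ : Fin n → Bool
  only-w₀ v = does (v ≟ w₀)
  only⊆W : ∀ v → only-w₀ v ≡ true → W v ≡ true
  only⊆W v v≟w₀ = subst (λ x → W x ≡ true) (sym (≟⇒≡ v≟w₀)) Ww₀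
  collapses-only : Collapses only-w₀ identityLabelling
  collapses-only v w =
    mk⇔ inj₁ λ { (inj₁ v≡w) → v≡w ; (inj₂ (v≟w₀ , w≟w₀)) → trans (≟⇒≡ v≟w₀) (sym (≟⇒≡ w≟w₀)) }
  size : n ℕ.+ count n only-w₀ ≡ suc n
  size = trans (cong (n ℕ.+_) (trans (count-drop n only-w₀ (λ _ → false) w₀ (dec-true (w₀ ≟ w₀) refl) refl
                                                 (λ v v≢w₀ → dec-false (v ≟ w₀) v≢w₀))
                                      (cong suc (count-all-false n (λ _ → refl)))))
               (ℕₚ.+-comm n 1)
  grow : ∀ r (D : Fin n → Bool) → D w₀ ≡ true → (∀ v → D v ≡ true → W v ≡ true) →
         count n (λ v → W v ∧ not (D v)) ≡ r → ∀ {k} (L : Labelling n k) → Collapses D L →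
         k ℕ.+ count n D ≡ suc n →
         ∃[ k ] Σ[ L ∈ Labelling n k ] Collapses W L × k ℕ.+ count n W ≡ suc n
  grow zero D Dw₀ D⊆W W∖D≡∅ {k} L L↠D size =
    k , L , (λ v w → subst₂ (λ x y → _ ⇔ (v ≡ w ⊎ (x ≡ true × y ≡ true))) (W≡D v) (W≡D w) (L↠D v w))
      , trans (cong (k ℕ.+_) (count-cong n (sym ∘ W≡D))) size
    where
    W≡D : ∀ v → D v ≡ W v
    W≡D v = Boolₚ.⇔→≡ {z = true} (mk⇔ (D⊆W v) W⊆D)
      where
      W⊆D : W v ≡ true → D v ≡ true
      W⊆D Wv = Boolₚ.not-injective (subst (λ b → b ∧ not (D v) ≡ false) Wv (count≡0⇒false n _ W∖D≡∅ v))
  grow (suc r) D Dw₀ D⊆W W∖D≡1+r {zero} L L↠D size with label L w₀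
  ... | ()
  grow (suc r) D Dw₀ D⊆W W∖D≡1+r {suc k} L L↠D size with count≡suc⇒true n _ W∖D≡1+r
  ... | v₁ , v₁∈W∖D =
    grow r (insert v₁ D) (insert-⊇ v₁ D w₀ Dw₀) D′⊆W W∖D′≡r L′ L′↠D′
         (trans (cong (k ℕ.+_) (count-insert v₁ D Dv₁)) (trans (ℕₚ.+-suc k (count n D)) size))
    where
    Dv₁ : D v₁ ≡ false
    Dv₁ = Boolₚ.not-injective (Boolₚ.∧-conicalʳ (W v₁) _ v₁∈W∖D)
    L′ = proj₁ (collapse-insert L L↠D Dw₀ Dv₁)
    L′↠D′ = proj₂ (collapse-insert L L↠D Dw₀ Dv₁)
    D′⊆W : ∀ v → insert v₁ D v ≡ true → W v ≡ true
    D′⊆W v D′v with insert-cases v₁ D v D′v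
    ... | inj₁ Dv   = D⊆W v Dv
    ... | inj₂ refl = Boolₚ.∧-conicalˡ (W v₁) _ v₁∈W∖D
    W∖D′≡r : count n (λ v → W v ∧ not (insert v₁ D v)) ≡ r
    W∖D′≡r = ℕₚ.suc-injective (trans (sym (count-drop n _ _ v₁ v₁∈W∖D
      (trans (cong (λ b → W v₁ ∧ not b) (insert-self v₁ D)) (Boolₚ.∧-zeroʳ (W v₁)))
      (λ v v≢v₁ → cong (λ b → W v ∧ not b) (sym (insert-other v₁ D v v≢v₁))))) W∖D≡1+r)

module Graph {n m : ℕ} (G : Multigraph n m) where
  open Multigraph G

  joins-sym : ∀ {e v w} → Joins e v w → Joins e w v
  joins-sym (inj₁ (s≡v , t≡w)) = inj₂ (t≡w , s≡v)
  joins-sym (inj₂ (t≡v , s≡w)) = inj₁ (s≡w , t≡v)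

  src-joins-tgt : ∀ e → Joins e (src e) (tgt e)
  src-joins-tgt e = inj₁ (refl , refl)

  endpoint-cases : ∀ {e a b v w} → Joins e a b → Joins e v w → a ≡ v ⊎ a ≡ w
  endpoint-cases (inj₁ (refl , refl)) (inj₁ (refl , refl)) = inj₁ refl
  endpoint-cases (inj₁ (refl , refl)) (inj₂ (refl , refl)) = inj₂ refl
  endpoint-cases (inj₂ (refl , refl)) (inj₁ (refl , refl)) = inj₂ refl
  endpoint-cases (inj₂ (refl , refl)) (inj₂ (refl , refl)) = inj₁ refl

  reach-edge : ∀ {ok : Fin m → Set} {e v w} → ok e → Joins e v w → Reach ok v w
  reach-edge {e = e} ok-e e:v-w = step e ok-e here e:v-w

  reach-trans : ∀ {ok : Fin m → Set} {u v w} → Reach ok u v → Reach ok v w → Reach ok u w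
  reach-trans u→v here                 = u→v
  reach-trans u→v (step e ok-e v→x j) = step e ok-e (reach-trans u→v v→x) j

  reach-sym : ∀ {ok : Fin m → Set} {u v} → Reach ok u v → Reach ok v u
  reach-sym here                  = here
  reach-sym (step e ok-e u→x j) = reach-trans (reach-edge ok-e (joins-sym j)) (reach-sym u→x)

  reach-mono : ∀ {ok ok′ : Fin m → Set} {u v} → (∀ e → ok e → ok′ e) → Reach ok u v → Reach ok′ u v
  reach-mono ok⊆ok′ here                 = here
  reach-mono ok⊆ok′ (step e ok-e u→x j) = step e (ok⊆ok′ e ok-e) (reach-mono ok⊆ok′ u→x) j

  reach-through : ∀ {ok ok′ : Fin m → Set} e → (∀ f → ok′ f → ok f ⊎ f ≡ e) → ∀ {x y} → Reach ok′ x y →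
                  Reach ok x y ⊎ (∃₂ λ a b → Joins e a b × Reach ok x a × Reach ok b y)
  reach-through e ok′⊆ here = inj₁ here
  reach-through e ok′⊆ (step f ok′-f x→v j) with ok′⊆ f ok′-f | reach-through e ok′⊆ x→v
  ... | inj₁ ok-f | inj₁ x→v′                       = inj₁ (step f ok-f x→v′ j)
  ... | inj₁ ok-f | inj₂ (a , b , e:a-b , x→a , b→v) = inj₂ (a , b , e:a-b , x→a , step f ok-f b→v j)
  ... | inj₂ refl | inj₁ x→v′                       = inj₂ (_ , _ , j , x→v′ , here)
  ... | inj₂ refl | inj₂ (a , b , e:a-b , x→a , b→v) with endpoint-cases e:a-b j
  ...   | inj₁ refl = inj₂ (a , _ , j , x→a , here)
  ...   | inj₂ refl = inj₁ x→a

  Inside : ∀ {k} → Labelling n k → Fin m → Set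
  Inside L e = label L (src e) ≡ label L (tgt e)

  insideᵇ : ∀ {k} → Labelling n k → Fin m → Bool
  insideᵇ L e = does (label L (src e) ≟ label L (tgt e))

  crosses : ∀ {k} → Labelling n k → Fin m → Bool
  crosses L e = not (insideᵇ L e)

  crosses⇒¬inside : ∀ {k} (L : Labelling n k) e → crosses L e ≡ true → ¬ Inside L e
  crosses⇒¬inside L e crosses-e inside = Boolₚ.not-¬ (cong not (dec-true (label L (src e) ≟ label L (tgt e)) inside)) crosses-e

  ¬inside⇒crosses : ∀ {k} (L : Labelling n k) e → ¬ Inside L e → crosses L e ≡ true
  ¬inside⇒crosses L e outside = cong not (dec-false (label L (src e) ≟ label L (tgt e)) outside)

  ¬crosses⇒inside : ∀ {k} (L : Labelling n k) e → crosses L e ≡ false → Inside L e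
  ¬crosses⇒inside L e ¬crosses = ≟⇒≡ (Boolₚ.not-injective ¬crosses)

  joins-inside : ∀ {k} (L : Labelling n k) {e v w} → Inside L e → Joins e v w → label L v ≡ label L w
  joins-inside L inside (inj₁ (refl , refl)) = inside
  joins-inside L inside (inj₂ (refl , refl)) = sym inside

  reach-inside : ∀ {k} (L : Labelling n k) {ok : Fin m → Set} → (∀ e → ok e → Inside L e) →
                 ∀ {u v} → Reach ok u v → label L u ≡ label L v
  reach-inside L ok⇒inside here                  = refl
  reach-inside L ok⇒inside (step e ok-e u→x j) = trans (reach-inside L ok⇒inside u→x) (joins-inside L (ok⇒inside e ok-e) j)

  -- Induction on k: gluing the two classes at a crossing edge of T removes that crossing.
  crossings-≥ : ∀ {T : Fin m → Bool} → (∀ u v → Reach (InT T) u v) →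
                ∀ {k} (L : Labelling n k) → k ∸ 1 ≤ count m (λ e → T e ∧ crosses L e)
  crossings-≥         connected {zero}  L = z≤n
  crossings-≥ {T} connected {suc k} L = go k L
    where
    go : ∀ k (L : Labelling n (suc k)) → k ≤ count m (λ e → T e ∧ crosses L e)
    go zero    L = z≤n
    go (suc k) L with none-or-some m (λ e → T e ∧ crosses L e)
    ... | inj₁ none =
      ⊥-elim (ℕₚ.<⇒≱ (s≤s (s≤s z≤n)) (constant⇒≤1 L (λ u v → reach-inside L T⇒inside (connected u v))))
      where
      T⇒inside : ∀ e → T e ≡ true → Inside L e
      T⇒inside e Te = ¬crosses⇒inside L e (subst (λ b → b ∧ crosses L e ≡ false) Te (none e))
    ... | inj₂ (e , Te∧crosses) = ℕₚ.≤-trans (s≤s (go k L′)) fewer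
      where
      e-crosses = crosses⇒¬inside L e (Boolₚ.∧-conicalʳ _ _ Te∧crosses)
      L′ = glue L (src e) (tgt e) e-crosses
      fewer : count m (λ f → T f ∧ crosses L′ f) < count m (λ f → T f ∧ crosses L f)
      fewer = count-strict-mono m e
        (trans (cong (T e ∧_) (cong not (dec-true (_ ≟ _) (glue-joins L (src e) (tgt e) e-crosses)))) (Boolₚ.∧-zeroʳ (T e)))
        Te∧crosses
        (λ f T∧crosses′ → ∧-true (Boolₚ.∧-conicalˡ _ _ T∧crosses′) (¬inside⇒crosses L f
          (crosses⇒¬inside L′ f (Boolₚ.∧-conicalʳ _ _ T∧crosses′) ∘ glue-≡ L (src e) (tgt e) e-crosses)))

  connected⇒≥n-1 : ∀ {T : Fin m → Bool} → (∀ u v → Reach (InT T) u v) → n ∸ 1 ≤ count m T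
  connected⇒≥n-1 {T} connected = subst (n ∸ 1 ≤_) (count-cong m T∧crosses≡T) (crossings-≥ connected identityLabelling)
    where
    T∧crosses≡T : ∀ e → T e ∧ crosses identityLabelling e ≡ T e
    T∧crosses≡T e = trans (cong (T e ∧_) (¬inside⇒crosses identityLabelling e (noLoop e))) (Boolₚ.∧-identityʳ (T e))

  -- Removing a non-bridge from a connected set with n - 1 edges would leave a
  -- connected set with n - 2 edges.
  connected∧size⇒spanningTree : ∀ {T : Fin m → Bool} → (∀ u v → Reach (InT T) u v) → count m T ℕ.+ 1 ≡ n →
                                IsSpanningTree T
  connected∧size⇒spanningTree {T} connected size = connected , bridge
    where
    bridge : ∀ e → T e ≡ true → ¬ Reach (λ f → T f ≡ true × f ≢ e) (src e) (tgt e)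
    bridge e Te cycle = ℕₚ.<-irrefl refl (subst (_≤ count m T′) n-1≡ (connected⇒≥n-1 connected′))
      where
      T′ : Fin m → Bool
      T′ f = T f ∧ not (does (f ≟ e))
      into-T′ : ∀ f → T f ≡ true × f ≢ e → T′ f ≡ true
      into-T′ f (Tf , f≢e) = ∧-true Tf (cong not (dec-false (f ≟ e) f≢e))
      T⊆T′∪e : ∀ f → T f ≡ true → T′ f ≡ true ⊎ f ≡ e
      T⊆T′∪e f Tf with f ≟ e
      ... | yes f≡e = inj₂ f≡e
      ... | no  _   = inj₁ (∧-true Tf refl)
      bypass : ∀ {a b} → Joins e a b → Reach (InT T′) a b
      bypass (inj₁ (refl , refl)) = reach-mono into-T′ cycle
      bypass (inj₂ (refl , refl)) = reach-sym (reach-mono into-T′ cycle)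
      connected′ : ∀ u v → Reach (InT T′) u v
      connected′ u v with reach-through e T⊆T′∪e (connected u v)
      ... | inj₁ u→v                      = u→v
      ... | inj₂ (a , b , j , u→a , b→v) = reach-trans u→a (reach-trans (bypass j) b→v)
      T≡1+T′ : count m T ≡ suc (count m T′)
      T≡1+T′ = count-drop m T T′ e Te
        (trans (cong (λ b → T e ∧ not b) (dec-true (e ≟ e) refl)) (Boolₚ.∧-zeroʳ (T e)))
        (λ f f≢e → sym (trans (cong (λ b → T f ∧ not b) (dec-false (f ≟ e) f≢e)) (Boolₚ.∧-identityʳ (T f))))
      n-1≡ : n ∸ 1 ≡ suc (count m T′)
      n-1≡ = trans (cong (_∸ 1) (sym size)) (trans (ℕₚ.m+n∸n≡m (count m T) 1) T≡1+T′)

  class : ∀ {k} → Labelling n k → Fin k → Fin n → Bool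
  class L i v = does (label L v ≟ i)

  src-label : ∀ {k} (L : Labelling n k) {e v w} → Inside L e → Joins e v w → label L (src e) ≡ label L v
  src-label L inside (inj₁ (refl , refl)) = refl
  src-label L inside (inj₂ (refl , refl)) = inside

  classes-connected : ∀ {k} (L : Labelling n k) {ok : Fin m → Set} → (∀ e → ok e → Inside L e) →
                      (∀ v w → label L v ≡ label L w → Reach ok v w) → ∀ i → InducedConnected (class L i)
  classes-connected L {ok} ok⇒inside linked i u v u∈i v∈i = stay (linked u v (trans (≟⇒≡ u∈i) (sym (≟⇒≡ v∈i))))
    where
    stay : ∀ {x} → Reach ok u x → Reach (InducedEdge (class L i)) u x
    stay here                  = here
    stay (step e ok-e u→x j) = step e (dec-true (_ ≟ i) src∈i , dec-true (_ ≟ i) (trans (sym inside) src∈i)) (stay u→x) j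
      where
      inside = ok⇒inside e ok-e
      src∈i : label L (src e) ≡ i
      src∈i = trans (src-label L inside j) (trans (sym (reach-inside L ok⇒inside u→x)) (≟⇒≡ u∈i))

  partition : ∀ {k} (L : Labelling n k) → 2 ≤ k → (∀ i → InducedConnected (class L i)) → FeasiblePartition
  partition L 2≤k connected = record { part = label L ; two≤k = 2≤k ; onto = onto L ; partConn = connected }

  labelling : (P : FeasiblePartition) → Labelling n (FeasiblePartition.k P)
  labelling P = record { label = FeasiblePartition.part P ; onto = FeasiblePartition.onto P }

  feasible⇒2≤n : FeasiblePartition → 2 ≤ n
  feasible⇒2≤n P = two-labels⇒2≤n (labelling P) (FeasiblePartition.two≤k P)

  RatiosAbove : ℚ → Set
  RatiosAbove q = ∀ P → q ≤ℚ FeasiblePartition.ratio P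

  crossing-bound : ∀ {q} → RatiosAbove q → ∀ {k} (L : Labelling n k) → (∀ i → InducedConnected (class L i)) →
                   q * ℕq (k ∸ 1) ≤ℚ ℕq (count m (crosses L))
  crossing-bound {q} above {zero}        L _ = subst (_≤ℚ _) (sym (ℚₚ.*-zeroʳ q)) (ℕq-nonneg (count m (crosses L)))
  crossing-bound {q} above {suc zero}    L _ = subst (_≤ℚ _) (sym (ℚₚ.*-zeroʳ q)) (ℕq-nonneg (count m (crosses L)))
  crossing-bound     above {suc (suc k)} L connected =
    Equivalence.to (≤-frac⇔ {count m (crosses L)} {suc k} (s≤s z≤n)) (above (partition L (s≤s (s≤s z≤n)) connected))

  inducedEdgeᵇ≡∧ : ∀ W e → inducedEdgeᵇ W e ≡ W (src e) ∧ W (tgt e)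
  inducedEdgeᵇ≡∧ W e with W (src e) | W (tgt e)
  ... | true  | true  = refl
  ... | true  | false = refl
  ... | false | _     = refl

  inside-edges : ∀ {k} (L : Labelling n k) → count m (insideᵇ L) ≡ sum (λ i → count m (inducedEdgeᵇ (class L i)))
  inside-edges L = trans (count-split m (label L ∘ src) (insideᵇ L)) (sum-cong-≗ (λ i → count-cong m (same-class i)))
    where
    same-class : ∀ i e → insideᵇ L e ∧ class L i (src e) ≡ inducedEdgeᵇ (class L i) e
    same-class i e = trans (Boolₚ.⇔→≡ {z = true} (mk⇔ to from)) (sym (inducedEdgeᵇ≡∧ (class L i) e))
      where
      to : insideᵇ L e ∧ class L i (src e) ≡ true → class L i (src e) ∧ class L i (tgt e) ≡ true
      to h = ∧-true (dec-true (_ ≟ i) src∈i) (dec-true (_ ≟ i) (trans (sym inside) src∈i))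
        where
        inside : label L (src e) ≡ label L (tgt e)
        inside = ≟⇒≡ (Boolₚ.∧-conicalˡ (insideᵇ L e) _ h)
        src∈i : label L (src e) ≡ i
        src∈i = ≟⇒≡ (Boolₚ.∧-conicalʳ (insideᵇ L e) _ h)
      from : class L i (src e) ∧ class L i (tgt e) ≡ true → insideᵇ L e ∧ class L i (src e) ≡ true
      from h = ∧-true (dec-true (_ ≟ _) (trans src∈i (sym tgt∈i))) (dec-true (_ ≟ i) src∈i)
        where
        src∈i : label L (src e) ≡ i
        src∈i = ≟⇒≡ (Boolₚ.∧-conicalˡ (class L i (src e)) _ h)
        tgt∈i : label L (tgt e) ≡ i
        tgt∈i = ≟⇒≡ (Boolₚ.∧-conicalʳ (class L i (src e)) _ h)

  class-sizes : ∀ {k} (L : Labelling n k) → sum (λ i → count n (class L i) ∸ 1) ℕ.+ k ≡ n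
  class-sizes {k} L = trans (sum-pred k (λ i → count n (class L i)) nonempty)
                            (sym (trans (sym (count-all-true n (λ _ → refl))) (count-split n (label L) (λ _ → true))))
    where
    nonempty : ∀ i → 1 ≤ count n (class L i)
    nonempty i = count-≥1 n (class L i) (proj₁ (onto L i)) (dec-true (_ ≟ i) (proj₂ (onto L i)))

  collapse-inside : ∀ {W k} (L : Labelling n k) → Collapses W L → ∀ e → insideᵇ L e ≡ inducedEdgeᵇ W e
  collapse-inside {W} L L↠W e = trans (Boolₚ.⇔→≡ {z = true} (mk⇔ to from)) (sym (inducedEdgeᵇ≡∧ W e))
    where
    to : insideᵇ L e ≡ true → W (src e) ∧ W (tgt e) ≡ true
    to inside with Equivalence.to (L↠W (src e) (tgt e)) (≟⇒≡ inside)
    ... | inj₁ loop       = ⊥-elim (noLoop e loop)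
    ... | inj₂ (Ws , Wt) = ∧-true Ws Wt
    from : W (src e) ∧ W (tgt e) ≡ true → insideᵇ L e ≡ true
    from both = dec-true (_ ≟ _) (Equivalence.from (L↠W (src e) (tgt e))
                                   (inj₂ (Boolₚ.∧-conicalˡ (W (src e)) _ both , Boolₚ.∧-conicalʳ (W (src e)) _ both)))

  collapse-classes-connected : ∀ {W k} (L : Labelling n k) → InducedConnected W → Collapses W L →
                               ∀ i → InducedConnected (class L i)
  collapse-classes-connected {W} L W-connected L↠W = classes-connected L {ok = InducedEdge W}
    (λ e (Ws , Wt) → Equivalence.from (L↠W (src e) (tgt e)) (inj₂ (Ws , Wt))) linked
    where
    linked : ∀ v w → label L v ≡ label L w → Reach (InducedEdge W) v w
    linked v w v~w with Equivalence.to (L↠W v w) v~w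
    ... | inj₁ refl       = here
    ... | inj₂ (Wv , Ww) = W-connected v w Wv Ww

  treeSum-ite : ∀ X ρ → treeSum X ρ ≡ sumℚ m (λ e → if X e then ρ e else 0ℚ)
  treeSum-ite X ρ = sum-cong m summand≡
    where
    -- The summand of `treeSum` is bound in a `where` clause of Defs and cannot
    -- be named; `summands` reads it off the unfolded sum.
    summands : ∀ {k} {f : Fin k → ℚ} {x} → sumℚ k f ≡ x → Fin k → ℚ
    summands {f = f} _ = f
    summand≡ : ∀ e → summands (refl {x = treeSum X ρ}) e ≡ (if X e then ρ e else 0ℚ)
    summand≡ e with X e
    ... | true  = refl
    ... | false = refl

  treeSum-indicator : ∀ X (p : Fin m → Bool) c →
                      treeSum X (λ e → if p e then c else 0ℚ) ≡ ℕq (count m (λ e → X e ∧ p e)) * c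
  treeSum-indicator X p c =
    trans (treeSum-ite X _) (trans (sum-cong m (λ e → if-∧ (X e) (p e))) (sum-indicator m (λ e → X e ∧ p e) c))
    where
    if-∧ : ∀ a b → (if a then (if b then c else 0ℚ) else 0ℚ) ≡ (if a ∧ b then c else 0ℚ)
    if-∧ true  b = refl
    if-∧ false b = refl

  treeSum-const : ∀ X c → treeSum X (λ _ → c) ≡ ℕq (count m X) * c
  treeSum-const X c = trans (treeSum-indicator X (λ _ → true) c)
                            (cong (λ k → ℕq k * c) (count-cong m (λ e → Boolₚ.∧-identityʳ (X e))))

  treeSum-drop : ∀ (X Y : Fin m → Bool) ρ e → X e ≡ true → Y e ≡ false → (∀ f → f ≢ e → X f ≡ Y f) →
                 treeSum X ρ ≡ treeSum Y ρ + ρ e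
  treeSum-drop X Y ρ e Xe Ye rest = trans (treeSum-ite X ρ) (trans
    (sum-differ-at m _ _ e (ρ e) (trans (cong (λ b → if b then ρ e else 0ℚ) Xe)
                                          (trans (sym (ℚₚ.+-identityˡ (ρ e))) (cong (λ b → (if b then ρ e else 0ℚ) + ρ e) (sym Ye))))
                               (λ f f≢e → cong (λ b → if b then ρ f else 0ℚ) (rest f f≢e)))
    (cong (_+ ρ e) (sym (treeSum-ite Y ρ))))

  treeSum-none : ∀ X ρ → (∀ e → X e ≡ false) → treeSum X ρ ≡ 0ℚ
  treeSum-none X ρ none = trans (treeSum-ite X ρ) (trans (sum-cong m (λ e → cong (λ b → if b then ρ e else 0ℚ) (none e)))
                                                         (trans (sum-const m 0ℚ) (ℚₚ.*-zeroʳ (ℕq m))))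

  crossing-density : ∀ {k} → Labelling n k → Fin m → ℚ
  crossing-density {k} L e = if crosses L e then frac 1 (k ∸ 1) else 0ℚ

  crossing-density-admissible : ∀ {k} (L : Labelling n k) → 1 ≤ k ∸ 1 → Admissible (crossing-density L)
  crossing-density-admissible {k} L 1≤k-1 = (λ e → nonneg (crosses L e)) , λ T tree → begin
    1ℚ                                          ≡⟨ trans (ℚₚ.*-comm (ℕq (k ∸ 1)) q) (frac-* 1 1≤k-1) ⟨
    ℕq (k ∸ 1) * q                              ≤⟨ ℚₚ.*-monoʳ-≤-nonNeg q {{ℚ.nonNegative (frac-nonneg 1 (k ∸ 1))}}
                                                     (ℕq-mono (crossings-≥ (proj₁ tree) L)) ⟩
    ℕq (count m (λ e → T e ∧ crosses L e)) * q  ≡⟨ treeSum-indicator T (crosses L) q ⟨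
    treeSum T (crossing-density L)              ∎
    where
    open ℚₚ.≤-Reasoning
    q = frac 1 (k ∸ 1)
    nonneg : ∀ b → 0ℚ ≤ℚ (if b then q else 0ℚ)
    nonneg true  = frac-nonneg 1 (k ∸ 1)
    nonneg false = ℚₚ.≤-refl

module Kruskal {n m : ℕ} (G : Multigraph n m) (connected : Multigraph.Connected G) (v₀ : Fin n) where
  open Multigraph G
  open Graph G

  -- A stage of Kruskal's algorithm: the classes are the components of the
  -- forest chosen among the processed edges.
  record Forest (k : ℕ) : Set where
    field
      done           : Fin m → Bool
      forest         : Fin m → Bool
      classes        : Labelling n k
      forest-inside  : ∀ e → forest e ≡ true → Inside classes e
      done-inside    : ∀ e → done e ≡ true → Inside classes e
      classes-linked : ∀ v w → label classes v ≡ label classes w → Reach (InT forest) v w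
      size           : count m forest ℕ.+ k ≡ n

  open Forest

  initial : Forest n
  initial = record
    { done           = λ _ → false
    ; forest         = λ _ → false
    ; classes        = identityLabelling
    ; forest-inside  = λ _ ()
    ; done-inside    = λ _ ()
    ; classes-linked = λ v w v≡w → subst (Reach (InT (λ _ → false)) v) v≡w here
    ; size           = cong (ℕ._+ n) (count-all-false m (λ _ → refl))
    }

  skip : ∀ {k} (σ : Forest k) e → Inside (classes σ) e → Forest k
  skip σ e inside = record σ { done = insert e (done σ) ; done-inside = done-inside′ }
    where
    done-inside′ : ∀ f → insert e (done σ) f ≡ true → Inside (classes σ) f
    done-inside′ f e∪done-f with insert-cases e (done σ) f e∪done-f
    ... | inj₁ done-f = done-inside σ f done-f
    ... | inj₂ refl   = inside

  apart⇒∉forest : ∀ {k} (σ : Forest k) e → ¬ Inside (classes σ) e → forest σ e ≡ false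
  apart⇒∉forest σ e apart = Boolₚ.¬-not (apart ∘ forest-inside σ e)

  join : ∀ {k} (σ : Forest (suc k)) e → ¬ Inside (classes σ) e → Forest k
  join {k} σ e apart = record
    { done           = insert e (done σ)
    ; forest         = insert e (forest σ)
    ; classes        = classes′
    ; forest-inside  = inside′ (forest σ) (forest-inside σ)
    ; done-inside    = inside′ (done σ) (done-inside σ)
    ; classes-linked = linked′
    ; size           = trans (cong (ℕ._+ k) (count-insert e (forest σ) (apart⇒∉forest σ e apart)))
                             (trans (sym (ℕₚ.+-suc _ k)) (size σ))
    }
    where
    classes′ = glue (classes σ) (src e) (tgt e) apart
    inside′ : ∀ X → (∀ f → X f ≡ true → Inside (classes σ) f) → ∀ f → insert e X f ≡ true → Inside classes′ f
    inside′ X X-inside f e∪X-f with insert-cases e X f e∪X-f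
    ... | inj₁ X-f = glue-≡ (classes σ) (src e) (tgt e) apart (X-inside f X-f)
    ... | inj₂ refl = glue-joins (classes σ) (src e) (tgt e) apart
    extend : ∀ {v w} → Reach (InT (forest σ)) v w → Reach (InT (insert e (forest σ))) v w
    extend = reach-mono (insert-⊇ e (forest σ))
    to-src : ∀ x → label (classes σ) x ≡ label (classes σ) (src e) ⊎ label (classes σ) x ≡ label (classes σ) (tgt e) →
             Reach (InT (insert e (forest σ))) x (src e)
    to-src x (inj₁ x~src) = extend (classes-linked σ x (src e) x~src)
    to-src x (inj₂ x~tgt) = reach-trans (extend (classes-linked σ x (tgt e) x~tgt))
                                        (reach-edge (insert-self e (forest σ)) (joins-sym (src-joins-tgt e)))
    linked′ : ∀ v w → label classes′ v ≡ label classes′ w → Reach (InT (insert e (forest σ))) v w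
    linked′ v w v~w with glue-inv (classes σ) (src e) (tgt e) apart v w v~w
    ... | inj₁ v~w₀          = extend (classes-linked σ v w v~w₀)
    ... | inj₂ (v~e , w~e) = reach-trans (to-src v v~e) (reach-sym (to-src w w~e))

  finished : ∀ {k} (σ : Forest k) → (∀ e → done σ e ≡ true) → k ≡ 1
  finished {zero} σ _ with label (classes σ) v₀
  ... | ()
  finished {suc zero}    σ _        = refl
  finished {suc (suc k)} σ all-done = ⊥-elim (ℕₚ.<⇒≱ (s≤s (s≤s z≤n)) (constant⇒≤1 (classes σ) same-class))
    where
    same-class : ∀ v w → label (classes σ) v ≡ label (classes σ) w
    same-class v w = reach-inside (classes σ) (λ e _ → done-inside σ e (all-done e)) (connected v w)

  spanningTree : (σ : Forest 1) → IsSpanningTree (forest σ)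
  spanningTree σ = connected∧size⇒spanningTree (λ v w → classes-linked σ v w (Fin1-≡ _ _)) (size σ)

  module _ (ρ : Fin m → ℚ) {S : ℚ} (above : RatiosAbove S) where

    undone : ∀ {k} → Forest k → Fin m → Bool
    undone σ = not ∘ done σ

    potential : ∀ {k} → Forest k → ℚ
    potential σ = treeSum (undone σ) ρ + S * treeSum (forest σ) ρ

    classes-bound : ∀ {k} (σ : Forest k) → S * ℕq (k ∸ 1) ≤ℚ ℕq (count m (undone σ))
    classes-bound σ = ℚₚ.≤-trans
      (crossing-bound above (classes σ) (classes-connected (classes σ) (forest-inside σ) (classes-linked σ)))
      (ℕq-mono (count-mono m crossing⇒undone))
      where
      crossing⇒undone : ∀ e → crosses (classes σ) e ≡ true → undone σ e ≡ true
      crossing⇒undone e crossing = cong not (Boolₚ.¬-not (crosses⇒¬inside (classes σ) e crossing ∘ done-inside σ e))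

    slack : ℕ → ℕ → ℚ
    slack k u = ℕq u - S * ℕq (k ∸ 1)

    TreeBound : ∀ {k} → Forest k → ℚ → ℕ → Set
    TreeBound {k} σ t u =
      ∃[ T ] IsSpanningTree T × count m T ℕ.+ 1 ≡ n × t * slack k u + S * treeSum T ρ ≤ℚ potential σ

    -- Kruskal's algorithm processes a cheapest undone edge at each stage. If t
    -- bounds the remaining weights from below, the potential of the current
    -- stage covers t · slack + S ρ(T) for the spanning tree T finally produced.
    KruskalBound : ℕ → Set
    KruskalBound u = ∀ {k} (σ : Forest k) → count m (undone σ) ≡ u →
                     ∀ t → (∀ e → done σ e ≡ false → t ≤ℚ ρ e) → TreeBound σ t u

    kruskal-done : KruskalBound 0
    kruskal-done σ none t _ with finished σ (λ e → Boolₚ.not-injective (count≡0⇒false m (undone σ) none e))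
    ... | refl = forest σ , spanningTree σ , size σ , ℚₚ.≤-reflexive (begin
      t * (0ℚ - S * 0ℚ) + S * treeSum (forest σ) ρ
        ≡⟨ solve 3 (λ t s w → t :* (con 0ℚ :- s :* con 0ℚ) :+ s :* w := con 0ℚ :+ s :* w)
                   refl t S (treeSum (forest σ) ρ) ⟩
      0ℚ + S * treeSum (forest σ) ρ
        ≡⟨ cong (_+ S * treeSum (forest σ) ρ) (treeSum-none (undone σ) ρ (count≡0⇒false m (undone σ) none)) ⟨
      potential σ ∎)
      where open ≡-Reasoning

    treeBound-step : ∀ {k k′} (σ : Forest k) (σ′ : Forest k′) u δ {t r} → t ≤ℚ r → 0ℚ ≤ℚ slack k (suc u) →
                     slack k (suc u) ≡ slack k′ u + δ → potential σ ≡ potential σ′ + r * δ →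
                     TreeBound σ′ r u → TreeBound σ t (suc u)
    treeBound-step σ σ′ u δ t≤r 0≤slack slack≡ potential≡ (T , tree , size , bound) =
      T , tree , size , descent-step t≤r 0≤slack slack≡ potential≡ bound

    Cheapest : ∀ {k} → Forest k → Fin m → Set
    Cheapest σ e = done σ e ≡ false × (∀ f → done σ f ≡ false → ρ e ≤ℚ ρ f)

    module Step {k} (σ : Forest k) {e} (cheapest : Cheapest σ e) {u} (undone≡1+u : count m (undone σ) ≡ suc u) where

      e∉done : done σ e ≡ false
      e∉done = proj₁ cheapest

      undone′ : Fin m → Bool
      undone′ = not ∘ insert e (done σ)

      undone-drop : ∀ f → f ≢ e → undone σ f ≡ undone′ f
      undone-drop f f≢e = cong not (sym (insert-other e (done σ) f f≢e))

      undone′≡u : count m undone′ ≡ u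
      undone′≡u = ℕₚ.suc-injective (trans (sym (count-drop m (undone σ) undone′ e (cong not e∉done)
                                                  (cong not (insert-self e (done σ))) undone-drop)) undone≡1+u)

      weight-undone : treeSum (undone σ) ρ ≡ treeSum undone′ ρ + ρ e
      weight-undone = treeSum-drop (undone σ) undone′ ρ e (cong not e∉done) (cong not (insert-self e (done σ))) undone-drop

      e-min′ : ∀ f → insert e (done σ) f ≡ false → ρ e ≤ℚ ρ f
      e-min′ f done′-f = proj₂ cheapest f (Boolₚ.∨-conicalˡ _ _ done′-f)

      0≤slack : 0ℚ ≤ℚ slack k (suc u)
      0≤slack = ≤⇒0≤- (subst (λ c → S * ℕq (k ∸ 1) ≤ℚ ℕq c) undone≡1+u (classes-bound σ))

    skip-bound : ∀ {u} → KruskalBound u → ∀ {k} (σ : Forest k) {e} (cheapest : Cheapest σ e) →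
                 Inside (classes σ) e → (undone≡1+u : count m (undone σ) ≡ suc u) →
                 ∀ {t} → t ≤ℚ ρ e → TreeBound σ t (suc u)
    skip-bound {u} IH {k} σ {e} cheapest inside undone≡1+u t≤ρe =
      treeBound-step σ (skip σ e inside) u 1ℚ t≤ρe 0≤slack slack≡ potential≡
                     (IH (skip σ e inside) undone′≡u (ρ e) e-min′)
      where
      open Step σ cheapest undone≡1+u
      κ = ℕq (k ∸ 1)
      slack≡ : slack k (suc u) ≡ slack k u + 1ℚ
      slack≡ = trans (cong (_- S * κ) (ℕq-suc u))
                     (solve 3 (λ u s κ → (con 1ℚ :+ u) :- s :* κ := (u :- s :* κ) :+ con 1ℚ) refl (ℕq u) S κ)
      potential≡ : potential σ ≡ potential (skip σ e inside) + ρ e * 1ℚ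
      potential≡ = trans (cong (_+ S * treeSum (forest σ) ρ) weight-undone)
        (solve 3 (λ a r b → (a :+ r) :+ b := (a :+ b) :+ r :* con 1ℚ) refl (treeSum undone′ ρ) (ρ e) (S * treeSum (forest σ) ρ))

    join-bound : ∀ {u} → KruskalBound u → ∀ {k} (σ : Forest k) {e} (cheapest : Cheapest σ e) →
                 ¬ Inside (classes σ) e → (undone≡1+u : count m (undone σ) ≡ suc u) →
                 ∀ {t} → t ≤ℚ ρ e → TreeBound σ t (suc u)
    join-bound IH {zero} σ _ _ _ _ with label (classes σ) v₀
    ... | ()
    join-bound IH {suc zero} σ _ apart _ _ = ⊥-elim (apart (Fin1-≡ _ _))
    join-bound {u} IH {suc (suc k)} σ {e} cheapest apart undone≡1+u t≤ρe =
      treeBound-step σ (join σ e apart) u (1ℚ - S) t≤ρe 0≤slack slack≡ potential≡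
                     (IH (join σ e apart) undone′≡u (ρ e) e-min′)
      where
      open Step σ cheapest undone≡1+u
      slack≡ : slack (suc (suc k)) (suc u) ≡ slack (suc k) u + (1ℚ - S)
      slack≡ = trans (cong₂ (λ x y → x - S * y) (ℕq-suc u) (ℕq-suc k))
                     (solve 3 (λ u s κ → (con 1ℚ :+ u) :- s :* (con 1ℚ :+ κ) := (u :- s :* κ) :+ (con 1ℚ :- s))
                            refl (ℕq u) S (ℕq k))
      weight-forest : treeSum (insert e (forest σ)) ρ ≡ treeSum (forest σ) ρ + ρ e
      weight-forest = treeSum-drop (insert e (forest σ)) (forest σ) ρ e (insert-self e (forest σ))
                        (apart⇒∉forest σ e apart) (insert-other e (forest σ))
      potential≡ : potential σ ≡ potential (join σ e apart) + ρ e * (1ℚ - S)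
      potential≡ = begin
        treeSum (undone σ) ρ + S * treeSum (forest σ) ρ
          ≡⟨ cong (_+ S * treeSum (forest σ) ρ) weight-undone ⟩
        (treeSum undone′ ρ + ρ e) + S * treeSum (forest σ) ρ
          ≡⟨ solve 4 (λ a r s f → (a :+ r) :+ s :* f := (a :+ s :* (f :+ r)) :+ r :* (con 1ℚ :- s))
                     refl (treeSum undone′ ρ) (ρ e) S (treeSum (forest σ) ρ) ⟩
        (treeSum undone′ ρ + S * (treeSum (forest σ) ρ + ρ e)) + ρ e * (1ℚ - S)
          ≡⟨ cong (λ w → (treeSum undone′ ρ + S * w) + ρ e * (1ℚ - S)) weight-forest ⟨
        potential (join σ e apart) + ρ e * (1ℚ - S) ∎
        where open ≡-Reasoning

    kruskal-step : ∀ u → KruskalBound u → KruskalBound (suc u)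
    kruskal-step u IH σ undone≡1+u t t≤ with none-or-minimum m (undone σ) ρ
    ... | inj₁ none = ⊥-elim (ℕₚ.1+n≢0 (trans (sym undone≡1+u) (count-all-false m none)))
    ... | inj₂ (e , e-undone , e-min) = process (label (classes σ) (src e) ≟ label (classes σ) (tgt e))
      where
      cheapest : Cheapest σ e
      cheapest = Boolₚ.not-injective e-undone , λ f f-not-done → e-min f (cong not f-not-done)
      process : Dec (Inside (classes σ) e) → TreeBound σ t (suc u)
      process (yes inside) = skip-bound IH σ cheapest inside undone≡1+u (t≤ e (proj₁ cheapest))
      process (no  apart)  = join-bound IH σ cheapest apart undone≡1+u (t≤ e (proj₁ cheapest))

    kruskal : ∀ u → KruskalBound u
    kruskal zero    = kruskal-done
    kruskal (suc u) = kruskal-step u (kruskal u)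

    cheap-spanningTree : (∀ e → 0ℚ ≤ℚ ρ e) →
                         ∃[ T ] IsSpanningTree T × count m T ℕ.+ 1 ≡ n × S * treeSum T ρ ≤ℚ sumℚ m ρ
    cheap-spanningTree ρ≥0 = tighten (kruskal _ initial refl 0ℚ (λ e _ → ρ≥0 e))
      where
      open ℚₚ.≤-Reasoning
      tighten : TreeBound initial 0ℚ (count m (undone initial)) →
                ∃[ T ] IsSpanningTree T × count m T ℕ.+ 1 ≡ n × S * treeSum T ρ ≤ℚ sumℚ m ρ
      tighten (T , tree , size , bound) = T , tree , size , (begin
        S * treeSum T ρ
          ≡⟨ solve 3 (λ x s w → s :* w := con 0ℚ :* x :+ s :* w) refl (slack n (count m (undone initial))) S (treeSum T ρ) ⟩
        0ℚ * slack n (count m (undone initial)) + S * treeSum T ρ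
          ≤⟨ bound ⟩
        treeSum (λ _ → true) ρ + S * treeSum (λ _ → false) ρ
          ≡⟨ cong₂ (λ a b → a + S * b) (treeSum-ite (λ _ → true) ρ) (treeSum-none _ ρ (λ _ → refl)) ⟩
        sumℚ m ρ + S * 0ℚ
          ≡⟨ solve 2 (λ a s → a :+ s :* con 0ℚ := a) refl (sumℚ m ρ) S ⟩
        sumℚ m ρ ∎)

module Energy {n m : ℕ} (G : Multigraph n m) where
  open Multigraph G
  open Graph G

  treeSum-combination : ∀ T (f g : Fin m → ℚ) α β →
                        treeSum T (λ e → α * f e + β * g e) ≡ α * treeSum T f + β * treeSum T g
  treeSum-combination T f g α β = begin
    treeSum T (λ e → α * f e + β * g e)
      ≡⟨ trans (treeSum-ite T _) (sum-cong m (λ e → if-combination (T e))) ⟩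
    sumℚ m (λ e → α * (if T e then f e else 0ℚ) + β * (if T e then g e else 0ℚ))
      ≡⟨ trans (sum-+ m _ _) (cong₂ _+_ (sum-*ˡ m α _) (sum-*ˡ m β _)) ⟩
    α * sumℚ m (λ e → if T e then f e else 0ℚ) + β * sumℚ m (λ e → if T e then g e else 0ℚ)
      ≡⟨ cong₂ (λ x y → α * x + β * y) (treeSum-ite T f) (treeSum-ite T g) ⟨
    α * treeSum T f + β * treeSum T g ∎
    where
    open ≡-Reasoning
    if-combination : ∀ {x y} b →
                     (if b then α * x + β * y else 0ℚ) ≡ α * (if b then x else 0ℚ) + β * (if b then y else 0ℚ)
    if-combination true  = refl
    if-combination false = sym (trans (cong₂ _+_ (ℚₚ.*-zeroʳ α) (ℚₚ.*-zeroʳ β)) (ℚₚ.+-identityˡ 0ℚ))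

  mix : ℚ → (Fin m → ℚ) → (Fin m → ℚ) → Fin m → ℚ
  mix t ρ ρ′ e = (1ℚ - t) * ρ e + t * ρ′ e

  admissible-mix : ∀ {ρ ρ′ t} → Admissible ρ → Admissible ρ′ → 0ℚ ≤ℚ t → t ≤ℚ 1ℚ → Admissible (mix t ρ ρ′)
  admissible-mix {ρ} {ρ′} {t} (ρ≥0 , ρ-trees) (ρ′≥0 , ρ′-trees) 0≤t t≤1 =
    (λ e → ℚₚ.+-mono-≤ (*-nonneg 0≤1-t (ρ≥0 e)) (*-nonneg 0≤t (ρ′≥0 e))) ,
    λ T tree → begin
      1ℚ                                            ≡⟨ solve 1 (λ t → con 1ℚ := (con 1ℚ :- t) :* con 1ℚ :+ t :* con 1ℚ) refl t ⟩
      (1ℚ - t) * 1ℚ + t * 1ℚ                        ≤⟨ ℚₚ.+-mono-≤ (ℚₚ.*-monoˡ-≤-nonNeg (1ℚ - t) {{ℚ.nonNegative 0≤1-t}} (ρ-trees T tree))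
                                                                   (ℚₚ.*-monoˡ-≤-nonNeg t {{ℚ.nonNegative 0≤t}} (ρ′-trees T tree)) ⟩
      (1ℚ - t) * treeSum T ρ + t * treeSum T ρ′     ≡⟨ treeSum-combination T ρ ρ′ (1ℚ - t) t ⟨
      treeSum T (mix t ρ ρ′)                        ∎
    where
    open ℚₚ.≤-Reasoning
    0≤1-t = ≤⇒0≤- t≤1

  energy-mix : ∀ ρ ρ′ t → energy (mix t ρ ρ′) ≡
               energy ρ + t * (sumℚ m (λ e → ρ e * (ρ′ e - ρ e)) + sumℚ m (λ e → ρ e * (ρ′ e - ρ e))
                               + t * sumℚ m (λ e → (ρ′ e - ρ e) * (ρ′ e - ρ e)))
  energy-mix ρ ρ′ t = begin
    energy (mix t ρ ρ′)
      ≡⟨ sum-cong m (λ e → solve 3 (λ t x y → ((con 1ℚ :- t) :* x :+ t :* y) :* ((con 1ℚ :- t) :* x :+ t :* y)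
                                    := x :* x :+ (t :* (x :* (y :- x) :+ x :* (y :- x)) :+ (t :* t) :* ((y :- x) :* (y :- x))))
                                  refl t (ρ e) (ρ′ e)) ⟩
    sumℚ m (λ e → ρ e * ρ e + (t * (X e + X e) + (t * t) * Y e))
      ≡⟨ trans (sum-+ m _ _) (cong (λ z → energy ρ + z) (trans (sum-+ m _ _)
           (cong₂ _+_ (trans (sum-*ˡ m t _) (cong (t *_) (sum-+ m X X))) (sum-*ˡ m (t * t) Y)))) ⟩
    energy ρ + (t * (sumℚ m X + sumℚ m X) + (t * t) * sumℚ m Y)
      ≡⟨ cong (λ z → energy ρ + z)
           (solve 3 (λ t x y → t :* (x :+ x) :+ (t :* t) :* y := t :* (x :+ x :+ t :* y)) refl t (sumℚ m X) (sumℚ m Y)) ⟩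
    energy ρ + t * (sumℚ m X + sumℚ m X + t * sumℚ m Y) ∎
    where
    open ≡-Reasoning
    X Y : Fin m → ℚ
    X e = ρ e * (ρ′ e - ρ e)
    Y e = (ρ′ e - ρ e) * (ρ′ e - ρ e)

  minimiser-variational : ∀ {ρ ρ′} → Admissible ρ → Admissible ρ′ → (∀ ρ″ → Admissible ρ″ → energy ρ ≤ℚ energy ρ″) →
                          0ℚ ≤ℚ sumℚ m (λ e → ρ e * (ρ′ e - ρ e))
  minimiser-variational {ρ} {ρ′} adm adm′ minimal =
    0≤p+p⇒0≤p (0≤slope _ _ (sum-nonneg m (λ e → square-nonneg (ρ′ e - ρ e))) gain≥0)
    where
    gain≥0 : ∀ t → 0ℚ <ℚ t → t ≤ℚ 1ℚ → 0ℚ ≤ℚ t * (sumℚ m (λ e → ρ e * (ρ′ e - ρ e)) + sumℚ m (λ e → ρ e * (ρ′ e - ρ e))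
                                                 + t * sumℚ m (λ e → (ρ′ e - ρ e) * (ρ′ e - ρ e)))
    gain≥0 t 0<t t≤1 =
      ≤+⇒0≤ (subst (energy ρ ≤ℚ_) (energy-mix ρ ρ′ t) (minimal _ (admissible-mix adm adm′ (ℚₚ.<⇒≤ 0<t) t≤1)))

module Theorem {n m : ℕ} (G : Multigraph n m) (connected : Multigraph.Connected G) (2≤n : 2 ≤ n) where
  open Multigraph G
  open Graph G
  open Energy G

  v₀ : Fin n
  v₀ = proj₁ (two-vertices 2≤n)

  open Kruskal G connected v₀

  1≤n-1 : 1 ≤ n ∸ 1
  1≤n-1 = ℕₚ.∸-monoˡ-≤ 1 2≤n

  0≤θG : 0ℚ ≤ℚ θG
  0≤θG = frac-nonneg m (n ∸ 1)

  θG-split : ∀ x y a b → x ℕ.+ y ≡ m → a ℕ.+ b ≡ n ∸ 1 → (θG * ℕq a ≤ℚ ℕq y ⇔ ℕq x ≤ℚ θG * ℕq b)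
  θG-split x y a b x+y≡m a+b≡n-1 = split-≤ {ℕq x} {ℕq y} {θG} {ℕq a} {ℕq b} (begin
    ℕq x + ℕq y        ≡⟨ ℕq-+ x y ⟨
    ℕq (x ℕ.+ y)       ≡⟨ cong ℕq x+y≡m ⟩
    ℕq m               ≡⟨ frac-* m 1≤n-1 ⟨
    θG * ℕq (n ∸ 1)    ≡⟨ cong (λ c → θG * ℕq c) a+b≡n-1 ⟨
    θG * ℕq (a ℕ.+ b)  ≡⟨ cong (θG *_) (ℕq-+ a b) ⟩
    θG * (ℕq a + ℕq b) ∎)
    where open ≡-Reasoning

  DensenessBelow : ℚ → Set
  DensenessBelow q = ∀ W → Candidate W → θ W ≤ℚ q

  discrete : FeasiblePartition
  discrete = partition identityLabelling 2≤n
    (classes-connected identityLabelling {ok = λ _ → ⊥} (λ _ ()) (λ v w v≡w → subst (Reach _ v) v≡w here))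

  discrete-ratio : FeasiblePartition.ratio discrete ≡ θG
  discrete-ratio = cong (λ c → frac c (n ∸ 1)) (count-all-true m (λ e → ¬inside⇒crosses identityLabelling e (noLoop e)))

  whole : Candidate (λ _ → true)
  whole = (λ u v _ _ → reach-mono (λ _ _ → refl , refl) (connected u v)) , some-edge
    where
    some-edge : ∃[ e ] InducedEdge (λ _ → true) e
    some-edge with two-vertices 2≤n
    ... | v , w , v≢w with connected v w
    ...   | here              = ⊥-elim (v≢w refl)
    ...   | step e _ _ _      = e , refl , refl

  whole-θ : θ (λ _ → true) ≡ θG
  whole-θ = cong₂ (λ a b → frac a (b ∸ 1)) (count-all-true m (λ _ → refl)) (count-all-true n (λ _ → refl))

  strength≤θG : ∀ {s} → IsStrength s → s ≤ℚ θG
  strength≤θG (_ , s≤ratios) = subst (_ ≤ℚ_) discrete-ratio (s≤ratios discrete)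

  θG≤denseness : ∀ {d} → IsMaxDenseness d → θG ≤ℚ d
  θG≤denseness (_ , dense≤d) = subst (_≤ℚ _) whole-θ (dense≤d (λ _ → true) whole)

  ratiosAbove⇒densenessBelow : RatiosAbove θG → DensenessBelow θG
  ratiosAbove⇒densenessBelow above W (W-connected , e₀ , W-src , W-tgt) with collapse W W-src
  ... | k , L , L↠W , size = Equivalence.from (frac-≤⇔ (ℕₚ.∸-monoˡ-≤ 1 2≤|W|)) (Equivalence.to split bound)
    where
    2≤|W| : 2 ≤ count n W
    2≤|W| = count-≥2 n W (src e₀) (tgt e₀) (noLoop e₀) W-src W-tgt
    split = θG-split (count m (inducedEdgeᵇ W)) (count m (not ∘ inducedEdgeᵇ W)) (k ∸ 1) (count n W ∸ 1)
                     (count-+-not m (inducedEdgeᵇ W))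
                     (pred-+ (ℕ.>-nonZero⁻¹ k {{Finₚ.nonZeroIndex (label L v₀)}}) (ℕₚ.≤-trans (s≤s z≤n) 2≤|W|) size)
    bound : θG * ℕq (k ∸ 1) ≤ℚ ℕq (count m (not ∘ inducedEdgeᵇ W))
    bound = subst (λ c → θG * ℕq (k ∸ 1) ≤ℚ ℕq c) (count-cong m (λ e → cong not (collapse-inside L L↠W e)))
                  (crossing-bound above L (collapse-classes-connected L W-connected L↠W))

  densenessBelow⇒ratiosAbove : DensenessBelow θG → RatiosAbove θG
  densenessBelow⇒ratiosAbove below P = Equivalence.from (≤-frac⇔ 1≤k-1) (Equivalence.from split IN≤θZ)
    where
    open FeasiblePartition P using (k; two≤k; partConn)
    L = labelling P
    1≤k-1 : 1 ≤ k ∸ 1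
    1≤k-1 = ℕₚ.∸-monoˡ-≤ 1 two≤k
    size edges : Fin k → ℕ
    size i = count n (class L i)
    edges i = count m (inducedEdgeᵇ (class L i))
    Z = sum (λ i → size i ∸ 1)
    split = θG-split (count m (insideᵇ L)) (count m (crosses L)) (k ∸ 1) Z (count-+-not m (insideᵇ L))
      (trans (ℕₚ.+-comm (k ∸ 1) Z)
             (trans (sym (ℕₚ.+-∸-assoc Z (ℕₚ.≤-trans (s≤s z≤n) two≤k))) (cong (_∸ 1) (class-sizes L))))
    per-class : ∀ i → ℕq (edges i) ≤ℚ θG * ℕq (size i ∸ 1)
    per-class i with none-or-some m (inducedEdgeᵇ (class L i))
    ... | inj₁ none = subst (_≤ℚ θG * ℕq (size i ∸ 1)) (cong ℕq (sym (count-all-false m none)))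
                            (*-nonneg 0≤θG (ℕq-nonneg (size i ∸ 1)))
    ... | inj₂ (e , e∈i) =
      Equivalence.to (frac-≤⇔ (ℕₚ.∸-monoˡ-≤ 1 2≤size)) (below (class L i) (partConn i , e , src∈i , tgt∈i))
      where
      both = subst (_≡ true) (inducedEdgeᵇ≡∧ (class L i) e) e∈i
      src∈i = Boolₚ.∧-conicalˡ (class L i (src e)) _ both
      tgt∈i = Boolₚ.∧-conicalʳ (class L i (src e)) _ both
      2≤size : 2 ≤ size i
      2≤size = count-≥2 n (class L i) (src e) (tgt e) (noLoop e) src∈i tgt∈i
    IN≤θZ : ℕq (count m (insideᵇ L)) ≤ℚ θG * ℕq Z
    IN≤θZ = begin
      ℕq (count m (insideᵇ L))                ≡⟨ cong ℕq (inside-edges L) ⟩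
      ℕq (sum edges)                          ≡⟨ ℕq-sum k edges ⟩
      sumℚ k (ℕq ∘ edges)                     ≤⟨ sum-mono k per-class ⟩
      sumℚ k (λ i → θG * ℕq (size i ∸ 1))     ≡⟨ sum-*ˡ k θG _ ⟩
      θG * sumℚ k (λ i → ℕq (size i ∸ 1))     ≡⟨ cong (θG *_) (ℕq-sum k (λ i → size i ∸ 1)) ⟨
      θG * ℕq Z                               ∎
      where open ℚₚ.≤-Reasoning

  spanningTree-exists : ∃[ T ] IsSpanningTree T × count m T ℕ.+ 1 ≡ n
  spanningTree-exists = map₂ (map₂ proj₁) (cheap-spanningTree (λ _ → 0ℚ) ratios≥0 (λ _ → ℚₚ.≤-refl))
    where
    ratios≥0 : RatiosAbove 0ℚ
    ratios≥0 P = frac-nonneg (FeasiblePartition.crossing P) (FeasiblePartition.k P ∸ 1)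

  admissible-constant-≥ : ∀ {c} → Admissible (λ _ → c) → frac 1 (n ∸ 1) ≤ℚ c
  admissible-constant-≥ {c} (_ , c-trees) with spanningTree-exists
  ... | T , tree , size = Equivalence.from (frac-≤⇔ 1≤n-1) (begin
    1ℚ                   ≤⟨ c-trees T tree ⟩
    treeSum T (λ _ → c)  ≡⟨ treeSum-const T c ⟩
    ℕq (count m T) * c   ≡⟨ cong (λ x → ℕq x * c) (trans (sym (ℕₚ.m+n∸n≡m (count m T) 1)) (cong (_∸ 1) size)) ⟩
    ℕq (n ∸ 1) * c       ≡⟨ ℚₚ.*-comm (ℕq (n ∸ 1)) c ⟩
    c * ℕq (n ∸ 1)       ∎)
    where open ℚₚ.≤-Reasoning

  homogeneous⇒ratiosAbove : Homogeneous → RatiosAbove θG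
  homogeneous⇒ratiosAbove (c , c-adm , c-minimal) P = begin
    θG                     ≡⟨ frac-scale m 1≤n-1 ⟩
    ℕq m * frac 1 (n ∸ 1)  ≤⟨ ℚₚ.*-monoˡ-≤-nonNeg (ℕq m) {{ℚ.nonNegative (ℕq-nonneg m)}} 1/[n-1]≤c ⟩
    ℕq m * c               ≤⟨ mc≤ratio ⟩
    ratio                  ∎
    where
    open ℚₚ.≤-Reasoning
    open FeasiblePartition P using (k; two≤k; ratio)
    L = labelling P
    1≤k-1 : 1 ≤ k ∸ 1
    1≤k-1 = ℕₚ.∸-monoˡ-≤ 1 two≤k
    1/[n-1]≤c = admissible-constant-≥ c-adm
    0<c : 0ℚ <ℚ c
    0<c = ℚₚ.<-≤-trans (frac-pos (s≤s z≤n) 1≤n-1) 1/[n-1]≤c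
    variation≡ : sumℚ m (λ e → c * (crossing-density L e - c)) ≡ c * (ratio - ℕq m * c)
    variation≡ = begin-equality
      sumℚ m (λ e → c * (crossing-density L e - c))          ≡⟨ sum-*ˡ m c (λ e → crossing-density L e - c) ⟩
      c * sumℚ m (λ e → crossing-density L e + - c)          ≡⟨ cong (c *_) (sum-+ m (crossing-density L) (λ _ → - c)) ⟩
      c * (sumℚ m (crossing-density L) + sumℚ m (λ _ → - c)) ≡⟨ cong₂ (λ x y → c * (x + y)) density-sum (sum-const m (- c)) ⟩
      c * (ratio + ℕq m * - c)                               ≡⟨ solve 3 (λ c r μ → c :* (r :+ μ :* (:- c)) := c :* (r :- μ :* c))
                                                                        refl c ratio (ℕq m) ⟩
      c * (ratio - ℕq m * c)                                 ∎
      where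
      density-sum : sumℚ m (crossing-density L) ≡ ratio
      density-sum = trans (sum-indicator m (crosses L) (frac 1 (k ∸ 1))) (sym (frac-scale (count m (crosses L)) 1≤k-1))
    0≤c[ratio-mc] : 0ℚ ≤ℚ c * (ratio - ℕq m * c)
    0≤c[ratio-mc] = subst (0ℚ ≤ℚ_) variation≡ (minimiser-variational c-adm (crossing-density-admissible L 1≤k-1) c-minimal)
    mc≤ratio : ℕq m * c ≤ℚ ratio
    mc≤ratio = 0≤-⇒≤ (ℚₚ.*-cancelˡ-≤-pos c {{ℚ.positive 0<c}}
                       (subst (_≤ℚ c * (ratio - ℕq m * c)) (sym (ℚₚ.*-zeroʳ c)) 0≤c[ratio-mc]))

  ratiosAbove⇒homogeneous : RatiosAbove θG → Homogeneous
  ratiosAbove⇒homogeneous above = c₁ , c₁-adm , c₁-minimal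
    where
    c₁ = frac 1 (n ∸ 1)
    0≤c₁ : 0ℚ ≤ℚ c₁
    0≤c₁ = frac-nonneg 1 (n ∸ 1)
    c₁-adm : Admissible (λ _ → c₁)
    c₁-adm = (λ _ → 0≤c₁) , λ T tree → begin
      1ℚ                   ≡⟨ trans (ℚₚ.*-comm (ℕq (n ∸ 1)) c₁) (frac-* 1 1≤n-1) ⟨
      ℕq (n ∸ 1) * c₁      ≤⟨ ℚₚ.*-monoʳ-≤-nonNeg c₁ {{ℚ.nonNegative 0≤c₁}} (ℕq-mono (connected⇒≥n-1 (proj₁ tree))) ⟩
      ℕq (count m T) * c₁  ≡⟨ treeSum-const T c₁ ⟨
      treeSum T (λ _ → c₁) ∎
      where open ℚₚ.≤-Reasoning
    c₁-minimal : ∀ ρ → Admissible ρ → energy (λ _ → c₁) ≤ℚ energy ρ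
    c₁-minimal ρ (ρ≥0 , ρ-trees) = bound (cheap-spanningTree ρ above ρ≥0)
      where
      open ℚₚ.≤-Reasoning
      bound : ∃[ T ] IsSpanningTree T × count m T ℕ.+ 1 ≡ n × θG * treeSum T ρ ≤ℚ sumℚ m ρ →
              energy (λ _ → c₁) ≤ℚ energy ρ
      bound (T , tree , _ , θρ[T]≤Σρ) = const-minimises-squares m c₁ ρ 0≤c₁ (begin
        ℕq m * c₁         ≡⟨ frac-scale m 1≤n-1 ⟨
        θG                ≡⟨ ℚₚ.*-identityʳ θG ⟨
        θG * 1ℚ           ≤⟨ ℚₚ.*-monoˡ-≤-nonNeg θG {{ℚ.nonNegative 0≤θG}} (ρ-trees T tree) ⟩
        θG * treeSum T ρ  ≤⟨ θρ[T]≤Σρ ⟩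
        sumℚ m ρ          ∎)

  strength≡θG⇔ratiosAbove : ∀ {s} → IsStrength s → (s ≡ θG ⇔ RatiosAbove θG)
  strength≡θG⇔ratiosAbove {s} strength@((P , ratio≡s) , s≤ratios) = mk⇔
    (λ s≡θG P′ → subst (_≤ℚ _) s≡θG (s≤ratios P′))
    (λ above → ℚₚ.≤-antisym (strength≤θG strength) (subst (θG ≤ℚ_) ratio≡s (above P)))

  denseness≡θG⇔densenessBelow : ∀ {d} → IsMaxDenseness d → (d ≡ θG ⇔ DensenessBelow θG)
  denseness≡θG⇔densenessBelow {d} denseness@((W , candidate , θW≡d) , dense≤d) = mk⇔
    (λ d≡θG W′ candidate′ → subst (_ ≤ℚ_) d≡θG (dense≤d W′ candidate′))
    (λ below → ℚₚ.≤-antisym (subst (_≤ℚ θG) θW≡d (below W candidate)) (θG≤denseness denseness))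

  strength≡denseness⇔strength≡θG : ∀ {s d} → IsStrength s → IsMaxDenseness d → (s ≡ d ⇔ s ≡ θG)
  strength≡denseness⇔strength≡θG strength denseness = mk⇔
    (λ s≡d → ℚₚ.≤-antisym (strength≤θG strength) (subst (θG ≤ℚ_) (sym s≡d) (θG≤denseness denseness)))
    (λ s≡θG → trans s≡θG (sym (Equivalence.from (denseness≡θG⇔densenessBelow denseness)
                                 (ratiosAbove⇒densenessBelow (Equivalence.to (strength≡θG⇔ratiosAbove strength) s≡θG)))))

mainTheorem11 : {n m : ℕ} (G : Multigraph n m) → Multigraph.Connected G →
    (s d : ℚ) → Multigraph.IsStrength G s → Multigraph.IsMaxDenseness G d →
      (Multigraph.Homogeneous G ⇔ (s ≡ Multigraph.θG G)) ×
      (Multigraph.Homogeneous G ⇔ (d ≡ Multigraph.θG G)) ×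
      (Multigraph.Homogeneous G ⇔ (s ≡ d))
mainTheorem11 G connected s d strength denseness = homogeneous⇔s≡θ , homogeneous⇔d≡θ , homogeneous⇔s≡d
  where
  open Multigraph G using (Homogeneous; θG)
  open Graph G using (RatiosAbove; feasible⇒2≤n)
  open Theorem G connected (feasible⇒2≤n (proj₁ (proj₁ strength)))
  homogeneous⇔ratiosAbove : Homogeneous ⇔ RatiosAbove θG
  homogeneous⇔ratiosAbove = mk⇔ homogeneous⇒ratiosAbove ratiosAbove⇒homogeneous
  ratiosAbove⇔densenessBelow : RatiosAbove θG ⇔ DensenessBelow θG
  ratiosAbove⇔densenessBelow = mk⇔ ratiosAbove⇒densenessBelow densenessBelow⇒ratiosAbove
  homogeneous⇔s≡θ : Homogeneous ⇔ (s ≡ θG)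
  homogeneous⇔s≡θ = ⇔-sym (strength≡θG⇔ratiosAbove strength) ⇔-∘ homogeneous⇔ratiosAbove
  homogeneous⇔d≡θ : Homogeneous ⇔ (d ≡ θG)
  homogeneous⇔d≡θ = ⇔-sym (denseness≡θG⇔densenessBelow denseness)
                      ⇔-∘ (ratiosAbove⇔densenessBelow ⇔-∘ homogeneous⇔ratiosAbove)
  homogeneous⇔s≡d : Homogeneous ⇔ (s ≡ d)
  homogeneous⇔s≡d = ⇔-sym (strength≡denseness⇔strength≡θG strength denseness) ⇔-∘ homogeneous⇔s≡θ
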